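{- Coefficientwise in $\mathbb{Z}[m,r][[s]]$, $$\lim_{n\rightarrow\infty}(rs^{n})^{ -1}G_{n}^{(2)}(m,r,s)=\prod_{j\ge0}\frac{1}{\xi(m,rs^{j},s)}.$$
   Context: For a subset $S\subseteq\{1,\dots,n\}$ let $|S|$ be its size and $\sigma(S)=\sum_{i\in S}i$. Segment: with $c(S)$ the number of maximal runs of consecutive integers in $S$, $G_n^{(s)}(m,r,s)=\sum_{S} s^{\sigma(S)}r^{|S|}m^{c(S)}(m-1)^{|S|-c(S)}$. Circle: for $n\ge3$, regard positions cyclically ($n$ and $1$ adjacent) and set $G_n^{(c)}(m,r,s)=\sum_{S} s^{\sigma(S)}r^{|S|}P_S(m)$, where $P_S(m)=m^{c_o(S)}(m-1)^{|S|-c_o(S)}$ for $S\neq\{1,\dots,n\}$ ($c_o(S)$ = number of maximal cyclic runs in $S$) and $P_S(m)=(m-1)^n+(-1)^n(m-1)$ for $S=\{1,\dots,n\}$; for $n\le2$, $G_n^{(c)}:=G_n^{(s)}$. For $n\ge2$, $G_n^{(2)}(m,r,s)=\frac{1}{m}\left(G_n^{(c)}(m,r,s)-G_{n-1}^{(s)}(m,r,s)\right)$, a polynomial divisible by $rs^n$. The series $\xi(m,r,s)$ is the unique formal power series in $r$ with coefficients in $\mathbb{Z}[m,s]$ satisfying $$1=(1+rs(m-2))\xi(m,r,s)+rs(1+s+rs^2(m-1))\xi(m,r,s)\xi(m,rs,s)+r^2s^4\xi(m,r,s)\xi(m,rs,s)\xi(m,rs^2,s)$$ (its constant term in $r$ is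 $1$). -}

module Defs where

open import Data.Nat using (ℕ; zero; suc; _+_; _*_; _∸_; _≤_; _≤ᵇ_; _≡ᵇ_)
open import Data.Integer as ℤ using (ℤ; 0ℤ; 1ℤ)
open import Data.Bool using (Bool; true; false; if_then_else_; _∧_)
open import Data.List using (List; []; _∷_; map; _++_; foldr)
open import Data.Bool.ListAction using (and)
open import Relation.Binary.PropositionalEquality using (_≡_)

-- Formal power series in three variables m, r, s over ℤ, i.e. elements of
-- ℤ[[m,r,s]], given by their coefficients:  F a b c = [m^a r^b s^c] F.
-- Polynomials in ℤ[m,r,s] and ℤ[m,r][[s]], ℤ[m,s][[r]] all embed here.

Series : Set
Series = ℕ → ℕ → ℕ → ℤ

sumTo : ℕ → (ℕ → ℤ) → ℤ
sumTo zero    f = f 0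
sumTo (suc n) f = sumTo n f ℤ.+ f (suc n)

monoS : ℕ → ℕ → ℕ → Series
monoS i j k a b c = if (a ≡ᵇ i) ∧ ((b ≡ᵇ j) ∧ (c ≡ᵇ k)) then 1ℤ else 0ℤ

0S 1S mS rS sS : Series
0S _ _ _ = 0ℤ
1S = monoS 0 0 0
mS = monoS 1 0 0
rS = monoS 0 1 0
sS = monoS 0 0 1

infixl 6 _+S_ _-S_
infixl 7 _*S_
infixr 8 _^S_

_+S_ : Series → Series → Series
(f +S g) a b c = f a b c ℤ.+ g a b c

-S_ : Series → Series
(-S f) a b c = ℤ.- f a b c

_-S_ : Series → Series → Series
f -S g = f +S (-S g)

_*S_ : Series → Series → Series
(f *S g) a b c =
  sumTo a λ i → sumTo b λ j → sumTo c λ k →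
    f i j k ℤ.* g (a ∸ i) (b ∸ j) (c ∸ k)

_^S_ : Series → ℕ → Series
f ^S zero  = 1S
f ^S suc n = f *S (f ^S n)

-- substitution r ↦ r s^j :  (substR j F)(m,r,s) = F(m, r s^j, s)
substR : ℕ → Series → Series
substR j f a b c = if (j * b) ≤ᵇ c then f a b (c ∸ j * b) else 0ℤ

-- multiplicative inverse of a series with constant term 1:
-- 1/F = Σ_k (1 - F)^k; the coefficient of total degree d only needs k ≤ d.
invS : Series → Series
invS f a b c = sumTo (a + b + c) λ k → ((1S -S f) ^S k) a b c

prodBelow : ℕ → (ℕ → Series) → Series
prodBelow zero    F = 1S
prodBelow (suc n) F = prodBelow n F *S F n

sumList : List Series → Series
sumList = foldr _+S_ 0S

-- Subsets of {1,…,n} as lists of n booleans; position i (from 0) ↔ element i+1.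

allSubsets : ℕ → List (List Bool)
allSubsets zero    = [] ∷ []
allSubsets (suc n) = map (false ∷_) (allSubsets n) ++ map (true ∷_) (allSubsets n)

size : List Bool → ℕ
size []           = 0
size (true ∷ xs)  = suc (size xs)
size (false ∷ xs) = size xs

sigmaFrom : ℕ → List Bool → ℕ
sigmaFrom k []       = 0
sigmaFrom k (x ∷ xs) = (if x then k else 0) + sigmaFrom (suc k) xs

sigma : List Bool → ℕ
sigma = sigmaFrom 1

-- number of run starts: elements in S whose predecessor (given by the flag) is not in S
runsFrom : Bool → List Bool → ℕ
runsFrom prev []           = 0
runsFrom prev (true ∷ xs)  = (if prev then 0 else 1) + runsFrom true xs
runsFrom prev (false ∷ xs) = runsFrom false xs

lastB : List Bool → Bool
lastB []           = false
lastB (x ∷ [])     = x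
lastB (_ ∷ y ∷ ys) = lastB (y ∷ ys)

runsSeg : List Bool → ℕ
runsSeg = runsFrom false

-- c_o(S): maximal cyclic runs (n adjacent to 1); used only for S ≠ {1,…,n}
runsCyc : List Bool → ℕ
runsCyc xs = runsFrom (lastB xs) xs

segTerm : List Bool → Series
segTerm S = sS ^S sigma S *S rS ^S size S *S mS ^S runsSeg S
            *S (mS -S 1S) ^S (size S ∸ runsSeg S)

Gs : ℕ → Series
Gs n = sumList (map segTerm (allSubsets n))

Pcyc : ℕ → List Bool → Series
Pcyc n S = if and S
  then (mS -S 1S) ^S n +S ((-S 1S) ^S n) *S (mS -S 1S)
  else mS ^S runsCyc S *S (mS -S 1S) ^S (size S ∸ runsCyc S)

cycTerm : ℕ → List Bool → Series
cycTerm n S = sS ^S sigma S *S rS ^S size S *S Pcyc n S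

Gc : ℕ → Series
Gc zero                      = Gs zero
Gc (suc zero)                = Gs (suc zero)
Gc (suc (suc zero))          = Gs (suc (suc zero))
Gc n@(suc (suc (suc _)))     = sumList (map (cycTerm n) (allSubsets n))

-- exact division by m (coefficient shift); G_n^{(c)} - G_{n-1}^{(s)} is divisible by m
divM : Series → Series
divM F a b c = F (suc a) b c

G2 : ℕ → Series
G2 n = divM (Gc n -S Gs (n ∸ 1))

-- (r s^n)^{-1} G_n^{(2)}  (exact division, coefficient shift)
normG2 : ℕ → Series
normG2 n a b c = G2 n a (suc b) (c + n)

xiEqRHS : Series → Series
xiEqRHS ξ =
  (1S +S rS *S sS *S (mS -S (1S +S 1S))) *S ξ
  +S rS *S sS *S (1S +S sS +S rS *S sS ^S 2 *S (mS -S 1S)) *S ξ *S substR 1 ξ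
  +S rS ^S 2 *S sS ^S 4 *S ξ *S substR 1 ξ *S substR 2 ξ

record IsXi (ξ : Series) : Set where
  field
    constTerm : ∀ a c → ξ a 0 c ≡ 1S a 0 c
    equation  : ∀ a b c → 1S a b c ≡ xiEqRHS ξ a b c

xiProd : Series → ℕ → Series
xiProd ξ n = prodBelow n (λ j → invS (substR j ξ))

module Submission where

-- Let Gs⁺ l be the weighted sum over the subsets of {1,…,l} in which a run is taken to be
-- open before 1. Splitting the subsets of the n-cycle according to whether they contain n
-- shows that (r s^n)⁻¹ G_n^(2) agrees with Gs⁺ (n - 1) below s-degree n - 1. Splitting the
-- subsets of a segment according to whether they contain 1 gives the recurrence
--   Gs⁺ (l + 3) = A · σ(Gs⁺ (l + 2)) + B · σ²(Gs⁺ (l + 1)) + C · σ³(Gs⁺ l),   σ F(r) = F(r s),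
-- where 1 = A ξ + B ξ σξ + C ξ σξ σ²ξ is the equation of ξ; multiplying that equation by
-- ∏_{j<l+3} 1/ξ(r s^j) shows that the partial products satisfy the same recurrence. Both
-- sequences have constant term 1 in r and stabilise below s-degree l at step l, and a solution
-- of Y = A σY + B σ²Y + C σ³Y below s-degree N is determined by its constant term in r: since
-- A = 1 + O(r), the coefficient of r^b s^c of Y is that of r^b s^(c - b) plus terms of lower r-degree.

open import Defs
open import Algebra.Bundles using (CommutativeRing)
import Algebra.Properties.AbelianGroup as AbelianGroupProperties
import Algebra.Properties.CommutativeSemigroup as CommutativeSemigroupProperties
import Algebra.Properties.Ring as RingProperties
import Algebra.Solver.Ring.NaturalCoefficients.Default as NaturalCoefficientsSolver
open import Data.Bool using (Bool; true; false; if_then_else_)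
open import Data.Bool.ListAction using (and)
open import Data.Empty using (⊥-elim)
open import Data.Integer as ℤ using (ℤ; 0ℤ; 1ℤ)
import Data.Integer.Properties as ℤP
open import Data.Integer.Solver using (module +-*-Solver)
open import Data.List using (List; []; _∷_; map; _++_; length; [_])
import Data.List.Properties as ListP
open import Data.Nat as ℕ using (ℕ; zero; suc; _∸_; _≤_; _<_; z≤n; s≤s; _≤ᵇ_; _≡ᵇ_)
open import Data.Nat.Induction using (<-rec)
import Data.Nat.Properties as ℕP
open import Data.Product using (_×_; _,_; proj₂; ∃-syntax)
open import Data.Sum using (_⊎_; inj₁; inj₂)
open import Function using (_∘_)
import Relation.Binary.PropositionalEquality as P
import Relation.Binary.Reasoning.Setoid as SetoidReasoning
open import Relation.Binary.Structures using (IsEquivalence)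
open import Relation.Nullary.Reflects using (ofʸ; ofⁿ)

module PowerSeries {c ℓ} (R : CommutativeRing c ℓ) where
  open CommutativeRing R
  open RingProperties ring using (-0#≈0#)
  open SetoidReasoning setoid

  Ser : Set c
  Ser = ℕ → Carrier

  infix 4 _≋_
  _≋_ : Ser → Ser → Set ℓ
  f ≋ g = ∀ n → f n ≈ g n

  ∑ : ℕ → (ℕ → Carrier) → Carrier
  ∑ zero    f = f 0
  ∑ (suc n) f = ∑ n f + f (suc n)

  infixl 6 _⊕_
  infixl 7 _⊛_

  _⊕_ : Ser → Ser → Ser
  (f ⊕ g) n = f n + g n

  ⊖_ : Ser → Ser
  (⊖ f) n = - f n

  𝟘 𝟙 : Ser
  𝟘 _ = 0#
  𝟙 zero    = 1#
  𝟙 (suc _) = 0#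

  _⊛_ : Ser → Ser → Ser
  (f ⊛ g) n = ∑ n λ i → f i * g (n ∸ i)

  ∑-cong : ∀ n {f g} → (∀ i → i ≤ n → f i ≈ g i) → ∑ n f ≈ ∑ n g
  ∑-cong zero    h = h 0 z≤n
  ∑-cong (suc n) h = +-cong (∑-cong n λ i i≤n → h i (ℕP.m≤n⇒m≤1+n i≤n)) (h (suc n) ℕP.≤-refl)

  ∑-zero : ∀ n f → (∀ i → i ≤ n → f i ≈ 0#) → ∑ n f ≈ 0#
  ∑-zero n f h = trans (∑-cong n h) (∑-0# n)
    where
    ∑-0# : ∀ n → ∑ n (λ _ → 0#) ≈ 0#
    ∑-0# zero    = refl
    ∑-0# (suc n) = trans (+-congʳ (∑-0# n)) (+-identityˡ 0#)

  ∑-+ : ∀ n f g → ∑ n (λ i → f i + g i) ≈ ∑ n f + ∑ n g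
  ∑-+ zero    f g = refl
  ∑-+ (suc n) f g = trans (+-congʳ (∑-+ n f g)) (+-interchange _ _ _ _)
    where open CommutativeSemigroupProperties +-commutativeSemigroup
            renaming (interchange to +-interchange)

  ∑-*ˡ : ∀ n x f → x * ∑ n f ≈ ∑ n (λ i → x * f i)
  ∑-*ˡ zero    x f = refl
  ∑-*ˡ (suc n) x f = trans (distribˡ x (∑ n f) (f (suc n))) (+-congʳ (∑-*ˡ n x f))

  ∑-suc : ∀ n f → ∑ (suc n) f ≈ f 0 + ∑ n (f ∘ suc)
  ∑-suc zero    f = refl
  ∑-suc (suc n) f = trans (+-congʳ (∑-suc n f)) (+-assoc _ _ _)

  ∑-reverse : ∀ n f → ∑ n f ≈ ∑ n (λ i → f (n ∸ i))
  ∑-reverse zero    f = refl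
  ∑-reverse (suc n) f = begin
    ∑ (suc n) f                              ≈⟨ ∑-suc n f ⟩
    f 0 + ∑ n (f ∘ suc)                      ≈⟨ +-congˡ (∑-reverse n (f ∘ suc)) ⟩
    f 0 + ∑ n (λ i → f (suc (n ∸ i)))        ≈⟨ +-comm _ _ ⟩
    ∑ n (λ i → f (suc (n ∸ i))) + f 0        ≈⟨ +-cong (∑-cong n λ i i≤n → reflexive (P.cong f (P.sym (ℕP.+-∸-assoc 1 i≤n))))
                                                       (reflexive (P.cong f (P.sym (ℕP.n∸n≡0 n)))) ⟩
    ∑ (suc n) (λ i → f (suc n ∸ i))          ∎

  ⊛-suc : ∀ f g n → (f ⊛ g) (suc n) ≈ f 0 * g (suc n) + ((f ∘ suc) ⊛ g) n
  ⊛-suc f g n = ∑-suc n λ i → f i * g (suc n ∸ i)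

  ⊛-cong : ∀ {f f′ g g′} → f ≋ f′ → g ≋ g′ → f ⊛ g ≋ f′ ⊛ g′
  ⊛-cong f≋f′ g≋g′ n = ∑-cong n λ i _ → *-cong (f≋f′ i) (g≋g′ (n ∸ i))

  ⊛-comm : ∀ f g → f ⊛ g ≋ g ⊛ f
  ⊛-comm f g n = trans (∑-reverse n _) (∑-cong n λ i i≤n →
    trans (*-comm _ _) (*-congʳ (reflexive (P.cong g (ℕP.m∸[m∸n]≡n i≤n)))))

  ⊛-distribˡ : ∀ h f g → h ⊛ (f ⊕ g) ≋ h ⊛ f ⊕ h ⊛ g
  ⊛-distribˡ h f g n = trans (∑-cong n λ i _ → distribˡ (h i) _ _) (∑-+ n _ _)

  ⊛-distribʳ : ∀ h f g → (f ⊕ g) ⊛ h ≋ f ⊛ h ⊕ g ⊛ h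
  ⊛-distribʳ h f g n = trans (∑-cong n λ i _ → distribʳ (h (n ∸ i)) _ _) (∑-+ n _ _)

  infixr 7 _·_
  _·_ : Carrier → Ser → Ser
  (x · f) n = x * f n

  ·-⊛ : ∀ x f g → (x · f) ⊛ g ≋ x · (f ⊛ g)
  ·-⊛ x f g n = trans (∑-cong n λ i _ → *-assoc x (f i) _) (sym (∑-*ˡ n x _))

  ⊛-assoc : ∀ f g h → (f ⊛ g) ⊛ h ≋ f ⊛ (g ⊛ h)
  ⊛-assoc f g h zero    = *-assoc (f 0) (g 0) (h 0)
  ⊛-assoc f g h (suc n) = begin
    ((f ⊛ g) ⊛ h) (suc n)
      ≈⟨ ⊛-suc (f ⊛ g) h n ⟩
    f 0 * g 0 * h (suc n) + (((f ⊛ g) ∘ suc) ⊛ h) n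
      ≈⟨ +-cong (*-assoc _ _ _) (⊛-cong {g = h} (⊛-suc f g) (λ _ → refl) n) ⟩
    f 0 * (g 0 * h (suc n)) + ((f 0 · (g ∘ suc) ⊕ (f ∘ suc) ⊛ g) ⊛ h) n
      ≈⟨ +-congˡ (trans (⊛-distribʳ h _ _ n) (+-cong (·-⊛ (f 0) (g ∘ suc) h n) (⊛-assoc (f ∘ suc) g h n))) ⟩
    f 0 * (g 0 * h (suc n)) + (f 0 * ((g ∘ suc) ⊛ h) n + ((f ∘ suc) ⊛ (g ⊛ h)) n)
      ≈⟨ trans (sym (+-assoc _ _ _)) (+-congʳ (sym (distribˡ _ _ _))) ⟩
    f 0 * (g 0 * h (suc n) + ((g ∘ suc) ⊛ h) n) + ((f ∘ suc) ⊛ (g ⊛ h)) n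
      ≈⟨ +-congʳ (*-congˡ (sym (⊛-suc g h n))) ⟩
    f 0 * (g ⊛ h) (suc n) + ((f ∘ suc) ⊛ (g ⊛ h)) n
      ≈⟨ sym (⊛-suc f (g ⊛ h) n) ⟩
    (f ⊛ (g ⊛ h)) (suc n) ∎

  ⊛-identityˡ : ∀ f → 𝟙 ⊛ f ≋ f
  ⊛-identityˡ f zero    = *-identityˡ (f 0)
  ⊛-identityˡ f (suc n) = begin
    (𝟙 ⊛ f) (suc n)                        ≈⟨ ⊛-suc 𝟙 f n ⟩
    1# * f (suc n) + ∑ n (λ i → 0# * _)    ≈⟨ +-cong (*-identityˡ _) (∑-zero n _ λ i _ → zeroˡ _) ⟩
    f (suc n) + 0#                         ≈⟨ +-identityʳ _ ⟩
    f (suc n)                              ∎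

  ≋-isEquivalence : IsEquivalence _≋_
  ≋-isEquivalence = record
    { refl = λ _ → refl ; sym = λ p n → sym (p n) ; trans = λ p q n → trans (p n) (q n) }

  powerSeriesRing : CommutativeRing c ℓ
  powerSeriesRing = record
    { Carrier = Ser ; _≈_ = _≋_ ; _+_ = _⊕_ ; _*_ = _⊛_ ; -_ = ⊖_ ; 0# = 𝟘 ; 1# = 𝟙
    ; isCommutativeRing = record
      { isRing = record
        { +-isAbelianGroup = record
          { isGroup = record
            { isMonoid = record
              { isSemigroup = record
                { isMagma = record
                  { isEquivalence = ≋-isEquivalence
                  ; ∙-cong = λ p q n → +-cong (p n) (q n) }
                ; assoc = λ f g h n → +-assoc (f n) (g n) (h n) }
              ; identity = (λ f n → +-identityˡ (f n)) , (λ f n → +-identityʳ (f n)) }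
            ; inverse = (λ f n → -‿inverseˡ (f n)) , (λ f n → -‿inverseʳ (f n))
            ; ⁻¹-cong = λ p n → -‿cong (p n) }
          ; comm = λ f g n → +-comm (f n) (g n) }
        ; *-cong = ⊛-cong
        ; *-assoc = ⊛-assoc
        ; *-identity = ⊛-identityˡ , λ f n → trans (⊛-comm f 𝟙 n) (⊛-identityˡ f n)
        ; distrib = ⊛-distribˡ , ⊛-distribʳ }
      ; *-comm = ⊛-comm } }

  module PS = CommutativeRing powerSeriesRing

  shift : ℕ → Ser → Ser
  shift p u n = if p ≤ᵇ n then u (n ∸ p) else 0#

  mono : ℕ → Carrier → Ser
  mono k x n = if n ≡ᵇ k then x else 0#

  shift-suc : ∀ k f n → shift (suc k) f (suc n) P.≡ shift k f n
  shift-suc zero    f n = P.refl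
  shift-suc (suc k) f n = P.refl

  mono-⊛ : ∀ k x f → mono k x ⊛ f ≋ x · shift k f
  mono-⊛ zero    x f zero    = refl
  mono-⊛ zero    x f (suc n) = trans (⊛-suc (mono 0 x) f n)
    (trans (+-congˡ (∑-zero n _ λ i _ → zeroˡ _)) (+-identityʳ _))
  mono-⊛ (suc k) x f zero    = trans (zeroˡ (f 0)) (sym (zeroʳ x))
  mono-⊛ (suc k) x f (suc n) = begin
    (mono (suc k) x ⊛ f) (suc n)     ≈⟨ ⊛-suc (mono (suc k) x) f n ⟩
    0# * f (suc n) + (mono k x ⊛ f) n ≈⟨ trans (+-cong (zeroˡ _) (mono-⊛ k x f n)) (+-identityˡ _) ⟩
    x * shift k f n                   ≡⟨ P.cong (x *_) (shift-suc k f n) ⟨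
    x * shift (suc k) f (suc n)       ∎

  shift-⊕ : ∀ p u v → shift p (u ⊕ v) ≋ shift p u ⊕ shift p v
  shift-⊕ p u v n with p ≤ᵇ n
  ... | true  = refl
  ... | false = sym (+-identityˡ 0#)

  shift-⊖ : ∀ p u → shift p (⊖ u) ≋ ⊖ shift p u
  shift-⊖ p u n with p ≤ᵇ n
  ... | true  = refl
  ... | false = sym -0#≈0#

  shift-shift : ∀ p q u → shift p (shift q u) ≋ shift (p ℕ.+ q) u
  shift-shift zero    q u n       = refl
  shift-shift (suc p) q u zero    = refl
  shift-shift (suc p) q u (suc n) = begin
    shift (suc p) (shift q u) (suc n) ≡⟨ shift-suc p (shift q u) n ⟩
    shift p (shift q u) n             ≈⟨ shift-shift p q u n ⟩
    shift (p ℕ.+ q) u n               ≡⟨ shift-suc (p ℕ.+ q) u n ⟨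
    shift (suc p ℕ.+ q) u (suc n)     ∎

  shift≋mono-⊛ : ∀ p f → shift p f ≋ mono p 1# ⊛ f
  shift≋mono-⊛ p f n = sym (trans (mono-⊛ p 1# f n) (*-identityˡ _))

  shift-mono : ∀ p q → shift p (mono q 1#) ≋ mono (p ℕ.+ q) 1#
  shift-mono zero    q n       = refl
  shift-mono (suc p) q zero    = refl
  shift-mono (suc p) q (suc n) = trans (reflexive (shift-suc p (mono q 1#) n)) (shift-mono p q n)

  shift-⊛ : ∀ p q u v → shift p u ⊛ shift q v ≋ shift (p ℕ.+ q) (u ⊛ v)
  shift-⊛ p q u v =
    PS.trans (⊛-cong (shift≋mono-⊛ p u) (shift≋mono-⊛ q v))
    (PS.trans (interchange (mono p 1#) u (mono q 1#) v)
    (PS.trans (⊛-cong {g = u ⊛ v} (PS.trans (PS.sym (shift≋mono-⊛ p (mono q 1#))) (shift-mono p q)) (λ _ → refl))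
              (PS.sym (shift≋mono-⊛ (p ℕ.+ q) (u ⊛ v)))))
    where open CommutativeSemigroupProperties PS.*-commutativeSemigroup using (interchange)

  shift-< : ∀ p u {n} → n ℕ.< p → shift p u n P.≡ 0#
  shift-< p u {n} n<p with p ≤ᵇ n | ℕP.≤ᵇ-reflects-≤ p n
  ... | true  | ofʸ p≤n = ⊥-elim (ℕP.<⇒≱ n<p p≤n)
  ... | false | _       = P.refl

  shift-≥ : ∀ p u {n} → p ≤ n → shift p u n P.≡ u (n ∸ p)
  shift-≥ p u {n} p≤n with p ≤ᵇ n | ℕP.≤ᵇ-reflects-≤ p n
  ... | true  | _       = P.refl
  ... | false | ofⁿ p≰n = ⊥-elim (p≰n p≤n)

  shift-cong-at : ∀ p {u v} n → (p ≤ n → u (n ∸ p) ≈ v (n ∸ p)) → shift p u n ≈ shift p v n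
  shift-cong-at p n agree with p ≤ᵇ n | ℕP.≤ᵇ-reflects-≤ p n
  ... | true  | ofʸ p≤n = agree p≤n
  ... | false | _       = refl

  shift-cong : ∀ p {u v} → u ≋ v → shift p u ≋ shift p v
  shift-cong p {u} {v} u≋v n = shift-cong-at p {u} {v} n λ _ → u≋v (n ∸ p)

open P using (_≡_; refl; cong; cong₂; sym; trans)

-- Series is ℤ⟦s⟧⟦r⟧⟦m⟧, which provides its ring structure.
module ℤ⟦s⟧ = PowerSeries ℤP.+-*-commutativeRing
module ℤ⟦r,s⟧ = PowerSeries ℤ⟦s⟧.powerSeriesRing
module ℤ⟦m,r,s⟧ = PowerSeries ℤ⟦r,s⟧.powerSeriesRing

infix 4 _≈S_
_≈S_ : Series → Series → Set
f ≈S g = ∀ a b c → f a b c ≡ g a b c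

sumTo-cong : ∀ n {f g : ℕ → ℤ} → (∀ i → i ≤ n → f i ≡ g i) → sumTo n f ≡ sumTo n g
sumTo-cong zero    h = h 0 z≤n
sumTo-cong (suc n) h = cong₂ ℤ._+_ (sumTo-cong n λ i i≤n → h i (ℕP.m≤n⇒m≤1+n i≤n)) (h (suc n) ℕP.≤-refl)

sumTo-zero : ∀ n (f : ℕ → ℤ) → (∀ i → i ≤ n → f i ≡ 0ℤ) → sumTo n f ≡ 0ℤ
sumTo-zero zero    f h = h 0 z≤n
sumTo-zero (suc n) f h = cong₂ ℤ._+_ (sumTo-zero n f λ i i≤n → h i (ℕP.m≤n⇒m≤1+n i≤n)) (h (suc n) ℕP.≤-refl)

*S≈⊛ : ∀ f g → f *S g ≈S ℤ⟦m,r,s⟧._⊛_ f g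
*S≈⊛ f g a b c = sym (trans (∑₃ a _ b c) (sumTo-cong a λ i _ →
  trans (∑₂ b _ c) (sumTo-cong b λ j _ → ∑₁ c _)))
  where
  ∑₁ : ∀ n h → ℤ⟦s⟧.∑ n h ≡ sumTo n h
  ∑₁ zero    h = refl
  ∑₁ (suc n) h = cong (ℤ._+ h (suc n)) (∑₁ n h)
  ∑₂ : ∀ n H c → ℤ⟦r,s⟧.∑ n H c ≡ sumTo n (λ i → H i c)
  ∑₂ zero    H c = refl
  ∑₂ (suc n) H c = cong (ℤ._+ H (suc n) c) (∑₂ n H c)
  ∑₃ : ∀ n H b c → ℤ⟦m,r,s⟧.∑ n H b c ≡ sumTo n (λ i → H i b c)
  ∑₃ zero    H b c = refl
  ∑₃ (suc n) H b c = cong (ℤ._+ H (suc n) b c) (∑₃ n H b c)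

1S≈𝟙 : 1S ≈S ℤ⟦m,r,s⟧.𝟙
1S≈𝟙 zero    zero    zero    = refl
1S≈𝟙 zero    zero    (suc c) = refl
1S≈𝟙 zero    (suc b) c       = refl
1S≈𝟙 (suc a) b       c       = refl

seriesRing : CommutativeRing _ _
seriesRing = record
  { Carrier = Series ; _≈_ = _≈S_ ; _+_ = _+S_ ; _*_ = _*S_ ; -_ = -S_ ; 0# = 0S ; 1# = 1S
  ; isCommutativeRing = record
    { isRing = record
      { +-isAbelianGroup = +-isAbelianGroup
      ; *-cong = λ {f} {f′} {g} {g′} p q →
          trans′ (*S≈⊛ f g) (trans′ (*-cong p q) (sym′ (*S≈⊛ f′ g′)))
      ; *-assoc = λ f g h →
          trans′ (*S≈⊛ (f *S g) h) (trans′ (*-cong (*S≈⊛ f g) (refl′ {h}))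
          (trans′ (*-assoc f g h) (trans′ (*-cong (refl′ {f}) (sym′ (*S≈⊛ g h))) (sym′ (*S≈⊛ f (g *S h))))))
      ; *-identity =
          (λ f → trans′ (*S≈⊛ 1S f) (trans′ (*-cong 1S≈𝟙 (refl′ {f})) (*-identityˡ f))) ,
          (λ f → trans′ (*S≈⊛ f 1S) (trans′ (*-cong (refl′ {f}) 1S≈𝟙) (*-identityʳ f)))
      ; distrib =
          (λ h f g → trans′ (*S≈⊛ h (f +S g)) (trans′ (distribˡ h f g) (+-cong (sym′ (*S≈⊛ h f)) (sym′ (*S≈⊛ h g))))) ,
          (λ h f g → trans′ (*S≈⊛ (f +S g) h) (trans′ (distribʳ h f g) (+-cong (sym′ (*S≈⊛ f h)) (sym′ (*S≈⊛ g h))))) }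
    ; *-comm = λ f g → trans′ (*S≈⊛ f g) (trans′ (*-comm f g) (sym′ (*S≈⊛ g f))) } }
  where
  open ℤ⟦m,r,s⟧.PS renaming (refl to refl′; sym to sym′; trans to trans′)


module SR = CommutativeRing seriesRing
open SetoidReasoning SR.setoid
open NaturalCoefficientsSolver SR.commutativeSemiring using (solve; _:+_; _:*_; _:^_; _:=_; con)
module ℤS = +-*-Solver

+S-congˡ : ∀ u {p q} → p ≈S q → u +S p ≈S u +S q
+S-congˡ u e a b c = cong (λ z → u a b c ℤ.+ z) (e a b c)

+S-congʳ : ∀ u {p q} → p ≈S q → p +S u ≈S q +S u
+S-congʳ u e a b c = cong (ℤ._+ u a b c) (e a b c)

+S-cong : ∀ {p q u v} → p ≈S q → u ≈S v → p +S u ≈S q +S v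
+S-cong e e′ a b c = cong₂ ℤ._+_ (e a b c) (e′ a b c)

-S-cong : ∀ {p q} → p ≈S q → -S p ≈S -S q
-S-cong e a b c = cong ℤ.-_ (e a b c)

*S-congˡ : ∀ u p q → p ≈S q → u *S p ≈S u *S q
*S-congˡ u p q e = SR.*-cong {u} {u} {p} {q} (SR.refl {u}) e

*S-congʳ : ∀ u p q → p ≈S q → p *S u ≈S q *S u
*S-congʳ u p q e = SR.*-cong {p} {q} {u} {u} e (SR.refl {u})

*S-cong : ∀ p q u v → p ≈S q → u ≈S v → p *S u ≈S q *S v
*S-cong p q u v e e′ = SR.*-cong {p} {q} {u} {v} e e′

^S-cong : ∀ {f g} n → f ≈S g → f ^S n ≈S g ^S n
^S-cong zero    e = SR.refl {1S}
^S-cong {f} {g} (suc n) e = *S-cong f g (f ^S n) (g ^S n) e (^S-cong n e)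

^S-+ : ∀ f m n → f ^S (m ℕ.+ n) ≈S f ^S m *S f ^S n
^S-+ f zero    n = SR.sym (SR.*-identityˡ (f ^S n))
^S-+ f (suc m) n = SR.trans (*S-congˡ f _ _ (^S-+ f m n)) (SR.sym (SR.*-assoc f (f ^S m) (f ^S n)))

^S-*S : ∀ f g n → (f *S g) ^S n ≈S f ^S n *S g ^S n
^S-*S f g zero    = SR.sym (SR.*-identityˡ 1S)
^S-*S f g (suc n) = SR.trans (*S-congˡ (f *S g) _ _ (^S-*S f g n))
  (solve 4 (λ f g x y → (f :* g) :* (x :* y) := (f :* x) :* (g :* y)) SR.refl f g (f ^S n) (g ^S n))

≡0⇒*≡0ˡ : ∀ {x} y → x ≡ 0ℤ → x ℤ.* y ≡ 0ℤ
≡0⇒*≡0ˡ y refl = ℤP.*-zeroˡ y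

≡0⇒*≡0ʳ : ∀ x {y} → y ≡ 0ℤ → x ℤ.* y ≡ 0ℤ
≡0⇒*≡0ʳ x refl = ℤP.*-zeroʳ x

*S-coeff-cong : ∀ f g f′ g′ a b c →
  (∀ i j k → i ≤ a → j ≤ b → k ≤ c →
     f i j k ℤ.* g (a ∸ i) (b ∸ j) (c ∸ k) ≡ f′ i j k ℤ.* g′ (a ∸ i) (b ∸ j) (c ∸ k)) →
  (f *S g) a b c ≡ (f′ *S g′) a b c
*S-coeff-cong f g f′ g′ a b c h =
  sumTo-cong a λ i i≤ → sumTo-cong b λ j j≤ → sumTo-cong c λ k k≤ → h i j k i≤ j≤ k≤

*S-coeff-zero : ∀ f g a b c →
  (∀ i j k → i ≤ a → j ≤ b → k ≤ c → f i j k ℤ.* g (a ∸ i) (b ∸ j) (c ∸ k) ≡ 0ℤ) →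
  (f *S g) a b c ≡ 0ℤ
*S-coeff-zero f g a b c h =
  sumTo-zero a _ λ i i≤ → sumTo-zero b _ λ j j≤ → sumTo-zero c _ λ k k≤ → h i j k i≤ j≤ k≤

shiftS shiftR shiftM : ℕ → Series → Series
shiftS k f a b = ℤ⟦s⟧.shift k (f a b)
shiftR k f a   = ℤ⟦r,s⟧.shift k (f a)
shiftM k f     = ℤ⟦m,r,s⟧.shift k f

shift-zero : ∀ p (u : ℕ → ℤ) c → (∀ c → u c ≡ 0ℤ) → ℤ⟦s⟧.shift p u c ≡ 0ℤ
shift-zero p u c h with p ≤ᵇ c
... | true  = h (c ∸ p)
... | false = refl

monoS-*S : ∀ i j k f → monoS i j k *S f ≈S shiftM i (λ a → ℤ⟦r,s⟧.shift j (λ b → ℤ⟦s⟧.shift k (f a b)))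
monoS-*S i j k f a b c =
  trans (*S≈⊛ (monoS i j k) f a b c)
  (trans (ℤ⟦m,r,s⟧.⊛-cong {g = f} monoS≈mono (λ _ → ℤ⟦r,s⟧.PS.refl) a b c)
  (trans (ℤ⟦m,r,s⟧.mono-⊛ i X₂ f a b c) (inM (i ℕ.≤ᵇ a))))
  where
  X₁ = ℤ⟦s⟧.mono k 1ℤ
  X₂ = ℤ⟦r,s⟧.mono j X₁
  monoS≈mono : monoS i j k ≈S ℤ⟦m,r,s⟧.mono i X₂
  monoS≈mono a b c with a ≡ᵇ i
  ... | false = refl
  ... | true with b ≡ᵇ j
  ... | false = refl
  ... | true with c ≡ᵇ k
  ... | false = refl
  ... | true  = refl
  inS : ∀ h → ℤ⟦s⟧._⊛_ X₁ h c ≡ ℤ⟦s⟧.shift k h c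
  inS h = trans (ℤ⟦s⟧.mono-⊛ k 1ℤ h c) (ℤP.*-identityˡ _)
  zero-if : ∀ z → (if z then 0ℤ else 0ℤ) ≡ 0ℤ
  zero-if true  = refl
  zero-if false = refl
  inR : ∀ g → ℤ⟦r,s⟧._⊛_ X₂ g b c ≡ ℤ⟦r,s⟧.shift j (λ b → ℤ⟦s⟧.shift k (g b)) b c
  inR g = trans (ℤ⟦r,s⟧.mono-⊛ j X₁ g b c) (cases (j ℕ.≤ᵇ b))
    where
    cases : ∀ z → ℤ⟦s⟧._⊛_ X₁ (if z then g (b ∸ j) else ℤ⟦s⟧.𝟘) c
                  ≡ (if z then ℤ⟦s⟧.shift k (g (b ∸ j)) else ℤ⟦s⟧.𝟘) c
    cases true  = inS (g (b ∸ j))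
    cases false = trans (inS ℤ⟦s⟧.𝟘) (zero-if (k ℕ.≤ᵇ c))
  inM : ∀ z → ℤ⟦r,s⟧._⊛_ X₂ (if z then f (a ∸ i) else ℤ⟦r,s⟧.𝟘) b c
              ≡ (if z then ℤ⟦r,s⟧.shift j (λ b → ℤ⟦s⟧.shift k (f (a ∸ i) b)) else ℤ⟦r,s⟧.𝟘) b c
  inM true  = inR (f (a ∸ i))
  inM false = trans (inR ℤ⟦r,s⟧.𝟘) zero-shifts
    where
    zero-shifts : ℤ⟦r,s⟧.shift j (λ b → ℤ⟦s⟧.shift k ℤ⟦s⟧.𝟘) b c ≡ 0ℤ
    zero-shifts with j ℕ.≤ᵇ b
    ... | false = refl
    ... | true  = zero-if (k ℕ.≤ᵇ c)

sS^-*S : ∀ k f → sS ^S k *S f ≈S shiftS k f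
sS^-*S zero    f = SR.*-identityˡ f
sS^-*S (suc k) f =
  SR.trans (SR.*-assoc sS (sS ^S k) f) (SR.trans (monoS-*S 0 0 1 (sS ^S k *S f))
  (SR.trans (λ a b → ℤ⟦s⟧.shift-cong 1 (sS^-*S k f a b)) (λ a b → ℤ⟦s⟧.shift-shift 1 k (f a b))))

rS-*S : ∀ f → rS *S f ≈S shiftR 1 f
rS-*S = monoS-*S 0 1 0

mS-*S : ∀ f → mS *S f ≈S shiftM 1 f
mS-*S = monoS-*S 1 0 0

substR-cong : ∀ j {f g} → f ≈S g → substR j f ≈S substR j g
substR-cong j f≈g a b = ℤ⟦s⟧.shift-cong (j ℕ.* b) (f≈g a b)

substR-+S : ∀ j f g → substR j (f +S g) ≈S substR j f +S substR j g
substR-+S j f g a b = ℤ⟦s⟧.shift-⊕ (j ℕ.* b) (f a b) (g a b)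

substR--S : ∀ j f → substR j (-S f) ≈S -S substR j f
substR--S j f a b = ℤ⟦s⟧.shift-⊖ (j ℕ.* b) (f a b)

substR-*S : ∀ j f g → substR j (f *S g) ≈S substR j f *S substR j g
substR-*S j f g =
  SR.trans {substR j (f *S g)} {substR j (ℤ⟦m,r,s⟧._⊛_ f g)} (substR-cong j (*S≈⊛ f g))
  (SR.trans (λ a → ℤ⟦r,s⟧.PS.trans (substR-∑₃ a _) (ℤ⟦m,r,s⟧.∑-cong a λ i _ → substR-⊛₂ (f i) (g (a ∸ i))))
  (SR.sym (*S≈⊛ (substR j f) (substR j g))))
  where
  sub₂ : (ℕ → ℕ → ℤ) → (ℕ → ℕ → ℤ)
  sub₂ h b = ℤ⟦s⟧.shift (j ℕ.* b) (h b)
  shift-∑₂ : ∀ p n H → ℤ⟦s⟧.shift p (ℤ⟦r,s⟧.∑ n H) ℤ⟦s⟧.≋ ℤ⟦r,s⟧.∑ n (λ i → ℤ⟦s⟧.shift p (H i))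
  shift-∑₂ p zero    H = ℤ⟦s⟧.PS.refl
  shift-∑₂ p (suc n) H = ℤ⟦s⟧.PS.trans (ℤ⟦s⟧.shift-⊕ p (ℤ⟦r,s⟧.∑ n H) (H (suc n))) (ℤ⟦s⟧.PS.+-cong (shift-∑₂ p n H) ℤ⟦s⟧.PS.refl)
  substR-∑₃ : ∀ n H → sub₂ (ℤ⟦m,r,s⟧.∑ n H) ℤ⟦r,s⟧.≋ ℤ⟦m,r,s⟧.∑ n (λ i → sub₂ (H i))
  substR-∑₃ zero    H = ℤ⟦r,s⟧.PS.refl
  substR-∑₃ (suc n) H b = ℤ⟦s⟧.PS.trans (ℤ⟦s⟧.shift-⊕ (j ℕ.* b) (ℤ⟦m,r,s⟧.∑ n H b) (H (suc n) b)) (ℤ⟦s⟧.PS.+-cong (substR-∑₃ n H b) ℤ⟦s⟧.PS.refl)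
  substR-⊛₂ : ∀ h k → sub₂ (ℤ⟦r,s⟧._⊛_ h k) ℤ⟦r,s⟧.≋ ℤ⟦r,s⟧._⊛_ (sub₂ h) (sub₂ k)
  substR-⊛₂ h k b = ℤ⟦s⟧.PS.trans (shift-∑₂ (j ℕ.* b) b _) (ℤ⟦r,s⟧.∑-cong b λ i i≤b →
    ℤ⟦s⟧.PS.trans
      (ℤ⟦s⟧.PS.reflexive (cong (λ z → ℤ⟦s⟧.shift z (ℤ⟦s⟧._⊛_ (h i) (k (b ∸ i))))
        (trans (cong (j ℕ.*_) (sym (ℕP.m+[n∸m]≡n i≤b))) (ℕP.*-distribˡ-+ j i (b ∸ i)))))
      (ℤ⟦s⟧.PS.sym (ℤ⟦s⟧.shift-⊛ (j ℕ.* i) (j ℕ.* (b ∸ i)) (h i) (k (b ∸ i)))))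

substR-const : ∀ j f → (∀ a b c → f a (suc b) c ≡ 0ℤ) → substR j f ≈S f
substR-const j f f-const a zero c rewrite ℕP.*-zeroʳ j = refl
substR-const j f f-const a (suc b) c with j ℕ.* suc b ℕ.≤ᵇ c
... | true  = trans (f-const a b _) (sym (f-const a b c))
... | false = sym (f-const a b c)

1S-const : ∀ a b c → 1S a (suc b) c ≡ 0ℤ
1S-const zero    b c = refl
1S-const (suc a) b c = refl

substR-1S : ∀ j → substR j 1S ≈S 1S
substR-1S j = substR-const j 1S 1S-const

substR-sS : ∀ j → substR j sS ≈S sS
substR-sS j = substR-const j sS λ { zero b c → refl ; (suc a) b c → refl }

substR-mS : ∀ j → substR j mS ≈S mS
substR-mS j = substR-const j mS λ { zero b c → refl ; (suc zero) b c → refl ; (suc (suc a)) b c → refl }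

substR-^S : ∀ j f n → substR j (f ^S n) ≈S substR j f ^S n
substR-^S j f zero    = substR-1S j
substR-^S j f (suc n) = SR.trans (substR-*S j f (f ^S n)) (*S-congˡ (substR j f) _ _ (substR-^S j f n))

substR-substR : ∀ i j f → substR i (substR j f) ≈S substR (i ℕ.+ j) f
substR-substR i j f a b c = trans (ℤ⟦s⟧.shift-shift (i ℕ.* b) (j ℕ.* b) (f a b) c)
  (cong (λ z → ℤ⟦s⟧.shift z (f a b) c) (sym (ℕP.*-distribʳ-+ b i j)))

substR-rS : ∀ j → substR j rS ≈S sS ^S j *S rS
substR-rS j a b c = trans (shift-r-degree a b) (sym (sS^-*S j rS a b c))
  where
  vanishes : ∀ p → ℤ⟦s⟧.shift p (λ _ → 0ℤ) c ≡ 0ℤ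
  vanishes p = shift-zero p _ c λ _ → refl
  shift-r-degree : ∀ a b → ℤ⟦s⟧.shift (j ℕ.* b) (rS a b) c ≡ ℤ⟦s⟧.shift j (rS a b) c
  shift-r-degree a       (suc zero)    = cong (λ z → ℤ⟦s⟧.shift z (rS a 1) c) (ℕP.*-identityʳ j)
  shift-r-degree zero    zero          = trans (vanishes (j ℕ.* 0)) (sym (vanishes j))
  shift-r-degree (suc a) zero          = trans (vanishes (j ℕ.* 0)) (sym (vanishes j))
  shift-r-degree zero    (suc (suc b)) = trans (vanishes (j ℕ.* suc (suc b))) (sym (vanishes j))
  shift-r-degree (suc a) (suc (suc b)) = trans (vanishes (j ℕ.* suc (suc b))) (sym (vanishes j))

-- Inverses and products

ConstTermOne : Series → Set
ConstTermOne f = ∀ a c → f a 0 c ≡ 1S a 0 c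

geometric : Series → ℕ → Series
geometric q zero    = 1S
geometric q (suc K) = geometric q K +S q ^S suc K

geometric-coeff : ∀ q K a b c → geometric q K a b c ≡ sumTo K (λ k → (q ^S k) a b c)
geometric-coeff q zero    a b c = refl
geometric-coeff q (suc K) a b c = cong (ℤ._+ (q ^S suc K) a b c) (geometric-coeff q K a b c)

geometric-telescopes : ∀ f q → f +S q ≈S 1S → ∀ K → f *S geometric q K +S q ^S suc K ≈S 1S
geometric-telescopes f q f+q≈1 zero = begin
  f *S 1S +S q *S 1S  ≈⟨ +S-cong (SR.*-identityʳ f) (SR.*-identityʳ q) ⟩
  f +S q              ≈⟨ f+q≈1 ⟩
  1S                  ∎
geometric-telescopes f q f+q≈1 (suc K) = begin
  f *S (geometric q K +S Q) +S q *S Q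
    ≈⟨ solve 4 (λ f q G Q → f :* (G :+ Q) :+ q :* Q := f :* G :+ (f :+ q) :* Q) SR.refl f q (geometric q K) Q ⟩
  f *S geometric q K +S (f +S q) *S Q
    ≈⟨ +S-congˡ (f *S geometric q K) (SR.trans (*S-congʳ Q _ _ f+q≈1) (SR.*-identityˡ Q)) ⟩
  f *S geometric q K +S Q
    ≈⟨ geometric-telescopes f q f+q≈1 K ⟩
  1S ∎
  where Q = q ^S suc K

module Inverse (f : Series) (f₀ : ConstTermOne f) where

  q : Series
  q = 1S -S f

  q-constTerm : ∀ a c → q a 0 c ≡ 0ℤ
  q-constTerm a c = trans (cong (λ z → 1S a 0 c ℤ.+ ℤ.- z) (f₀ a c)) (ℤP.+-inverseʳ (1S a 0 c))

  -- q is divisible by r, so q^k is divisible by r^k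
  q^-vanishes : ∀ k a b c → b < k → (q ^S k) a b c ≡ 0ℤ
  q^-vanishes (suc k) a b c b<k = *S-coeff-zero q (q ^S k) a b c λ i j l _ j≤b _ → term i j l j≤b
    where
    term : ∀ i j l → j ≤ b → q i j l ℤ.* (q ^S k) (a ∸ i) (b ∸ j) (c ∸ l) ≡ 0ℤ
    term i zero    l _   = ≡0⇒*≡0ˡ _ (q-constTerm i l)
    term i (suc j) l j<b = ≡0⇒*≡0ʳ (q i (suc j) l) (q^-vanishes k (a ∸ i) (b ∸ suc j) (c ∸ l) (b∸j<k b j j<b b<k))
      where
      b∸j<k : ∀ b j → suc j ≤ b → b < suc k → b ∸ suc j < k
      b∸j<k (suc b) j _ (s≤s b<k) = ℕP.≤-<-trans (ℕP.m∸n≤m b j) b<k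

  geometric-stable : ∀ K a b c → b ≤ K → geometric q K a b c ≡ geometric q b a b c
  geometric-stable zero    a b c b≤0 with ℕP.n≤0⇒n≡0 b≤0
  ... | refl = refl
  geometric-stable (suc K) a b c b≤K+1 with ℕP.m≤n⇒m<n∨m≡n b≤K+1
  ... | inj₂ refl       = refl
  ... | inj₁ (s≤s b≤K) = trans (cong (λ z → geometric q K a b c ℤ.+ z) (q^-vanishes (suc K) a b c (s≤s b≤K)))
                          (trans (ℤP.+-identityʳ _) (geometric-stable K a b c b≤K))

  f+q≈1 : f +S q ≈S 1S
  f+q≈1 = SR.trans (SR.sym (SR.+-assoc f 1S (-S f))) (xyx⁻¹≈y f 1S)
    where open AbelianGroupProperties SR.+-abelianGroup using (xyx⁻¹≈y)

  -- only the powers q^k with k ≤ b contribute to the coefficient of r^b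
  invS≡geometric : ∀ a b c → invS f a b c ≡ geometric q b a b c
  invS≡geometric a b c = trans (sym (geometric-coeff q (a ℕ.+ b ℕ.+ c) a b c))
    (geometric-stable _ a b c (ℕP.≤-trans (ℕP.m≤n+m b a) (ℕP.m≤m+n (a ℕ.+ b) c)))

  invS-inverseʳ : f *S invS f ≈S 1S
  invS-inverseʳ a b c =
    trans (*S-coeff-cong f (invS f) f (geometric q b) a b c λ i j k _ j≤b _ → cong (f i j k ℤ.*_)
            (trans (invS≡geometric (a ∸ i) (b ∸ j) (c ∸ k)) (sym (geometric-stable b _ _ _ (ℕP.m∸n≤m b j)))))
    (trans (sym (ℤP.+-identityʳ _))
    (trans (cong (λ z → (f *S geometric q b) a b c ℤ.+ z) (sym (q^-vanishes (suc b) a b c ℕP.≤-refl)))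
           (geometric-telescopes f q f+q≈1 b a b c)))

  invS-constTerm : ConstTermOne (invS f)
  invS-constTerm a c = invS≡geometric a 0 c

*S-inverse-unique : ∀ h u v → h *S u ≈S 1S → h *S v ≈S 1S → u ≈S v
*S-inverse-unique h u v hu≈1 hv≈1 = begin
  u               ≈⟨ SR.sym (SR.*-identityˡ u) ⟩
  1S *S u         ≈⟨ *S-congʳ u _ _ (SR.sym hv≈1) ⟩
  h *S v *S u     ≈⟨ solve 3 (λ h v u → h :* v :* u := h :* u :* v) SR.refl h v u ⟩
  h *S u *S v     ≈⟨ *S-congʳ v _ _ hu≈1 ⟩
  1S *S v         ≈⟨ SR.*-identityˡ v ⟩
  v               ∎

invS-cong : ∀ {f g} → f ≈S g → invS f ≈S invS g
invS-cong f≈g a b c = sumTo-cong (a ℕ.+ b ℕ.+ c) λ k _ → ^S-cong k (+S-congˡ 1S (-S-cong f≈g)) a b c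

substR-constTerm : ∀ j g → ConstTermOne g → ConstTermOne (substR j g)
substR-constTerm j g g₀ a c rewrite ℕP.*-zeroʳ j = g₀ a c

substR-invS : ∀ j g → ConstTermOne g → substR j (invS g) ≈S invS (substR j g)
substR-invS j g g₀ = *S-inverse-unique (substR j g) _ _
  (SR.trans (SR.sym (substR-*S j g (invS g))) (SR.trans (substR-cong j (Inverse.invS-inverseʳ g g₀)) (substR-1S j)))
  (Inverse.invS-inverseʳ (substR j g) (substR-constTerm j g g₀))

prodBelow-suc : ∀ n F → prodBelow (suc n) F ≈S F 0 *S prodBelow n (F ∘ suc)
prodBelow-suc zero    F = SR.*-comm 1S (F 0)
prodBelow-suc (suc n) F = SR.trans (*S-congʳ (F (suc n)) _ _ (prodBelow-suc n F)) (SR.*-assoc (F 0) (prodBelow n (F ∘ suc)) (F (suc n)))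

prodBelow-cong : ∀ n {F G} → (∀ j → F j ≈S G j) → prodBelow n F ≈S prodBelow n G
prodBelow-cong zero    F≈G = SR.refl {1S}
prodBelow-cong (suc n) {F} {G} F≈G = *S-cong _ _ (F n) (G n) (prodBelow-cong n F≈G) (F≈G n)

substR-prodBelow : ∀ j n F → substR j (prodBelow n F) ≈S prodBelow n (substR j ∘ F)
substR-prodBelow j zero    F = substR-1S j
substR-prodBelow j (suc n) F =
  SR.trans (substR-*S j (prodBelow n F) (F n)) (*S-congʳ (substR j (F n)) _ _ (substR-prodBelow j n F))

*S-constTerm : ∀ f g → ConstTermOne f → ConstTermOne g → ConstTermOne (f *S g)
*S-constTerm f g f₀ g₀ a c =
  trans (*S-coeff-cong f g 1S 1S a 0 c λ { i zero k _ _ _ → cong₂ ℤ._*_ (f₀ i k) (g₀ (a ∸ i) (c ∸ k)) })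
        (SR.*-identityˡ 1S a 0 c)

prodBelow-constTerm : ∀ n F → (∀ j → ConstTermOne (F j)) → ConstTermOne (prodBelow n F)
prodBelow-constTerm zero    F F₀ a c = refl
prodBelow-constTerm (suc n) F F₀ = *S-constTerm (prodBelow n F) (F n) (prodBelow-constTerm n F F₀) (F₀ n)

σ : Series → Series
σ = substR 1

wS tS : Series
wS = mS -S 1S
tS = mS -S (1S +S 1S)

mS≈wS+1S : mS ≈S wS +S 1S
mS≈wS+1S a b c = ℤS.solve 2 (λ m o → m ℤS.:= (m ℤS.:- o) ℤS.:+ o) refl (mS a b c) (1S a b c)

wS≈tS+1S : wS ≈S tS +S 1S
wS≈tS+1S a b c = ℤS.solve 2 (λ m o → m ℤS.:- o ℤS.:= (m ℤS.:- (o ℤS.:+ o)) ℤS.:+ o) refl (mS a b c) (1S a b c)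

xiCoeff₁ xiCoeff₂ xiCoeff₃ : Series
xiCoeff₁ = 1S +S rS *S sS *S tS
xiCoeff₂ = rS *S sS *S (1S +S sS +S rS *S sS ^S 2 *S wS)
xiCoeff₃ = rS ^S 2 *S sS ^S 4

recurrence : Series → Series → Series → Series
recurrence X Y Z = xiCoeff₁ *S σ X +S xiCoeff₂ *S σ (σ Y) +S xiCoeff₃ *S σ (σ (σ Z))

-- Agreement of coefficients on sets of (r-degree, s-degree)

Degrees : Set₁
Degrees = ℕ → ℕ → Set

infix 4 _≈S_on_
_≈S_on_ : Series → Series → Degrees → Set
f ≈S g on D = ∀ a b c → D b c → f a b c ≡ g a b c

DownClosed : Degrees → Set
DownClosed D = ∀ {b b′ c c′} → b′ ≤ b → c′ ≤ c → D b c → D b′ c′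

module _ {D : Degrees} where

  ≈S⇒on : ∀ {f g} → f ≈S g → f ≈S g on D
  ≈S⇒on f≈g a b c _ = f≈g a b c

  on-refl : ∀ f → f ≈S f on D
  on-refl f a b c _ = refl

  on-sym : ∀ {f g} → f ≈S g on D → g ≈S f on D
  on-sym f≈g a b c d = sym (f≈g a b c d)

  on-trans : ∀ {f g h} → f ≈S g on D → g ≈S h on D → f ≈S h on D
  on-trans f≈g g≈h a b c d = trans (f≈g a b c d) (g≈h a b c d)

  on-weaken : ∀ {E f g} → (∀ {b c} → E b c → D b c) → f ≈S g on D → f ≈S g on E
  on-weaken E⊆D f≈g a b c e = f≈g a b c (E⊆D e)

  +S-on : ∀ {f g f′ g′} → f ≈S g on D → f′ ≈S g′ on D → f +S f′ ≈S g +S g′ on D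
  +S-on f≈g f′≈g′ a b c d = cong₂ ℤ._+_ (f≈g a b c d) (f′≈g′ a b c d)

  *S-congˡ-on : DownClosed D → ∀ h {f g} → f ≈S g on D → h *S f ≈S h *S g on D
  *S-congˡ-on D↓ h {f} {g} f≈g a b c d = *S-coeff-cong h f h g a b c λ i j k _ _ _ →
    cong (h i j k ℤ.*_) (f≈g _ _ _ (D↓ (ℕP.m∸n≤m b j) (ℕP.m∸n≤m c k) d))

σ-coeff : ∀ f a b c → σ f a b c ≡ ℤ⟦s⟧.shift b (f a b) c
σ-coeff f a b c = cong (λ z → ℤ⟦s⟧.shift z (f a b) c) (ℕP.*-identityˡ b)

σ-coeff-cong : ∀ f g a b c → (b ≤ c → f a b (c ∸ b) ≡ g a b (c ∸ b)) → σ f a b c ≡ σ g a b c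
σ-coeff-cong f g a b c agree =
  trans (σ-coeff f a b c) (trans (ℤ⟦s⟧.shift-cong-at b {f a b} {g a b} c agree) (sym (σ-coeff g a b c)))

-- σ moves the coefficient of r^b s^c to r^b s^(c + b)
σ-on : ∀ {D E : Degrees} → (∀ {b c} → b ≤ c → E b c → D b (c ∸ b)) →
       ∀ {f g} → f ≈S g on D → σ f ≈S σ g on E
σ-on E⇒D {f} {g} f≈g a b c e = σ-coeff-cong f g a b c λ b≤c → f≈g a b (c ∸ b) (E⇒D b≤c e)

σ-on-self : ∀ {D} → DownClosed D → ∀ {f g} → f ≈S g on D → σ f ≈S σ g on D
σ-on-self D↓ = σ-on λ {b} {c} _ → D↓ ℕP.≤-refl (ℕP.m∸n≤m c b)

S< : ℕ → Degrees
S< N b c = c < N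

S<-downClosed : ∀ N → DownClosed (S< N)
S<-downClosed N _ c′≤c c<N = ℕP.≤-<-trans c′≤c c<N

RS< : ℕ → ℕ → Degrees
RS< B N b c = b < B × c < N

RS<-downClosed : ∀ B N → DownClosed (RS< B N)
RS<-downClosed B N b′≤b c′≤c (b<B , c<N) = ℕP.≤-<-trans b′≤b b<B , ℕP.≤-<-trans c′≤c c<N

-- the part of recurrenceTail Y of r-degree b only involves Y in r-degrees up to b
recurrenceTail : Series → Series
recurrenceTail Y =
  sS *S tS *S σ Y +S sS *S (1S +S sS +S rS *S sS ^S 2 *S wS) *S σ (σ Y) +S rS *S sS ^S 4 *S σ (σ (σ Y))

recurrence-diag : ∀ Y → recurrence Y Y Y ≈S σ Y +S rS *S recurrenceTail Y
recurrence-diag Y =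
  solve 8 (λ r s t u s⁴ y₁ y₂ y₃ →
      (con 1 :+ r :* s :* t) :* y₁ :+ r :* s :* u :* y₂ :+ r :^ 2 :* s⁴ :* y₃
    := y₁ :+ r :* (s :* t :* y₁ :+ s :* u :* y₂ :+ r :* s⁴ :* y₃))
  SR.refl rS sS tS (1S +S sS +S rS *S sS ^S 2 *S wS) (sS ^S 4) (σ Y) (σ (σ Y)) (σ (σ (σ Y)))

module _ (N : ℕ) where

  recurrenceTail-on : ∀ B {Y Y′} → Y ≈S Y′ on RS< B N → recurrenceTail Y ≈S recurrenceTail Y′ on RS< B N
  recurrenceTail-on B e =
    +S-on (+S-on (*S-congˡ-on ↓ (sS *S tS) (σ-on-self ↓ e))
                 (*S-congˡ-on ↓ (sS *S (1S +S sS +S rS *S sS ^S 2 *S wS)) (σ-on-self ↓ (σ-on-self ↓ e))))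
          (*S-congˡ-on ↓ (rS *S sS ^S 4) (σ-on-self ↓ (σ-on-self ↓ (σ-on-self ↓ e))))
    where ↓ = RS<-downClosed B N

  fixpoint-coeff : ∀ {Y} → Y ≈S recurrence Y Y Y on S< N →
    ∀ a b c → c < N → Y a (suc b) c ≡ σ Y a (suc b) c ℤ.+ recurrenceTail Y a b c
  fixpoint-coeff {Y} Y-fix a b c c<N =
    trans (Y-fix a (suc b) c c<N) (trans (recurrence-diag Y a (suc b) c)
          (cong (λ z → σ Y a (suc b) c ℤ.+ z) (rS-*S (recurrenceTail Y) a (suc b) c)))

  -- induction on the r-degree, and for fixed r-degree on the s-degree
  fixpoint-unique : ∀ {Y Y′} → Y ≈S recurrence Y Y Y on S< N → Y′ ≈S recurrence Y′ Y′ Y′ on S< N →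
    (∀ a c → Y a 0 c ≡ Y′ a 0 c) → Y ≈S Y′ on S< N
  fixpoint-unique {Y} {Y′} Y-fix Y′-fix Y≈Y′₀ a b c c<N = agree-below (suc b) a b c (ℕP.n<1+n b , c<N)
    where
    top-degree : ∀ b → Y ≈S Y′ on RS< b N → ∀ c → c < N → ∀ a → Y a b c ≡ Y′ a b c
    top-degree zero    _  c _ a = Y≈Y′₀ a c
    top-degree (suc b) ih = <-rec (λ c → c < N → ∀ a → Y a (suc b) c ≡ Y′ a (suc b) c) λ c rec c<N a →
      trans (fixpoint-coeff Y-fix a b c c<N)
      (trans (cong₂ ℤ._+_
                (σ-coeff-cong Y Y′ a (suc b) c λ 1+b≤c →
                   rec (ℕP.∸-monoʳ-< {o = 0} (s≤s z≤n) 1+b≤c) (ℕP.≤-<-trans (ℕP.m∸n≤m c (suc b)) c<N) a)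
                (recurrenceTail-on (suc b) ih a b c (ℕP.n<1+n b , c<N)))
             (sym (fixpoint-coeff Y′-fix a b c c<N)))
    agree-below : ∀ B → Y ≈S Y′ on RS< B N
    agree-below zero    a b c (() , _)
    agree-below (suc B) a b c (b<1+B , c<N) with ℕP.m≤n⇒m<n∨m≡n (ℕP.≤-pred b<1+B)
    ... | inj₁ b<B  = agree-below B a b c (b<B , c<N)
    ... | inj₂ refl = top-degree b (agree-below b) c c<N a

recurrence-on : ∀ {D} → DownClosed D → ∀ {X X′ Y Y′ Z Z′} →
  X ≈S X′ on D → Y ≈S Y′ on D → Z ≈S Z′ on D → recurrence X Y Z ≈S recurrence X′ Y′ Z′ on D
recurrence-on ↓ eX eY eZ =
  +S-on (+S-on (*S-congˡ-on ↓ xiCoeff₁ (σ-on-self ↓ eX))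
               (*S-congˡ-on ↓ xiCoeff₂ (σ-on-self ↓ (σ-on-self ↓ eY))))
        (*S-congˡ-on ↓ xiCoeff₃ (σ-on-self ↓ (σ-on-self ↓ (σ-on-self ↓ eZ))))

SatisfiesRecurrence : (ℕ → Series) → Set
SatisfiesRecurrence X = ∀ n → X (3 ℕ.+ n) ≈S recurrence (X (2 ℕ.+ n)) (X (1 ℕ.+ n)) (X n)

Stabilises : (ℕ → Series) → Set
Stabilises X = ∀ n → X (suc n) ≈S X n on S< n

stabilises-from : ∀ {X} → Stabilises X → ∀ N n → N ≤ n → X n ≈S X N on S< N
stabilises-from {X} X-stab N n N≤n with ℕP.m≤n⇒∃[o]m+o≡n N≤n
... | d , refl = shifted d
  where
  shifted : ∀ d → X (N ℕ.+ d) ≈S X N on S< N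
  shifted zero    = P.subst (λ n → X n ≈S X N on S< N) (sym (ℕP.+-identityʳ N)) (on-refl (X N))
  shifted (suc d) = P.subst (λ n → X n ≈S X N on S< N) (sym (ℕP.+-suc N d))
    (on-trans (on-weaken (λ c<N → ℕP.<-≤-trans c<N (ℕP.m≤m+n N d)) (X-stab (N ℕ.+ d))) (shifted d))

recurrence-solutions-agree : ∀ {X X′} → SatisfiesRecurrence X → SatisfiesRecurrence X′ →
  Stabilises X → Stabilises X′ → (∀ n a c → X n a 0 c ≡ X′ n a 0 c) →
  ∀ N n → N ≤ n → X n ≈S X′ n on S< N
recurrence-solutions-agree {X} {X′} X-rec X′-rec X-stab X′-stab same₀ N n N≤n =
  on-trans (stabilises-from X-stab N n N≤n)
  (on-trans (fixpoint-unique N (fixpoint X X-rec X-stab) (fixpoint X′ X′-rec X′-stab) (same₀ N))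
            (on-sym (stabilises-from X′-stab N n N≤n)))
  where
  fixpoint : ∀ X → SatisfiesRecurrence X → Stabilises X → X N ≈S recurrence (X N) (X N) (X N) on S< N
  fixpoint X X-rec X-stab =
    on-trans (on-sym (stabilises-from X-stab N (3 ℕ.+ N) (ℕP.m≤n+m N 3)))
    (on-trans (≈S⇒on (X-rec N))
              (recurrence-on (S<-downClosed N) (stabilises-from X-stab N (2 ℕ.+ N) (ℕP.m≤n+m N 2))
                                               (stabilises-from X-stab N (1 ℕ.+ N) (ℕP.m≤n+m N 1))
                                               (on-refl (X N))))

-- Partial products of 1/ξ(r s^j)

substR-S< : ∀ n h → ConstTermOne h → substR n h ≈S 1S on S< n
substR-S< n h h₀ a zero    c _   = substR-constTerm n h h₀ a c
substR-S< n h h₀ a (suc b) c c<n =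
  trans (ℤ⟦s⟧.shift-< (n ℕ.* suc b) (h a (suc b)) (ℕP.<-≤-trans c<n (ℕP.m≤m*n n (suc b)))) (sym (1S-const a b c))

module XiProduct (ξ : Series) (isXi : IsXi ξ) where

  ξ₀ : ConstTermOne ξ
  ξ₀ = IsXi.constTerm isXi

  Π : ℕ → Series
  Π = xiProd ξ

  xiProd-suc : ∀ n → Π (suc n) ≈S invS ξ *S σ (Π n)
  xiProd-suc n = SR.trans (prodBelow-suc n _) (*S-cong _ _ _ _ (invS-cong {substR 0 ξ} {ξ} λ _ _ _ → refl) (SR.sym σ-xiProd))
    where
    σ-xiProd : σ (Π n) ≈S prodBelow n (λ j → invS (substR (suc j) ξ))
    σ-xiProd = SR.trans (substR-prodBelow 1 n _) (prodBelow-cong n λ j →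
      SR.trans (substR-invS 1 (substR j ξ) (substR-constTerm j ξ ξ₀)) (invS-cong (substR-substR 1 j ξ)))

  ξ-*-xiProd-suc : ∀ n → ξ *S Π (suc n) ≈S σ (Π n)
  ξ-*-xiProd-suc n = begin
    ξ *S Π (suc n)              ≈⟨ *S-congˡ ξ _ _ (xiProd-suc n) ⟩
    ξ *S (invS ξ *S σ (Π n))    ≈⟨ SR.sym (SR.*-assoc ξ (invS ξ) (σ (Π n))) ⟩
    ξ *S invS ξ *S σ (Π n)      ≈⟨ *S-congʳ (σ (Π n)) _ _ (Inverse.invS-inverseʳ ξ ξ₀) ⟩
    1S *S σ (Π n)               ≈⟨ SR.*-identityˡ _ ⟩
    σ (Π n)                     ∎

  σξ-*-σxiProd-suc : ∀ n → σ ξ *S σ (Π (suc n)) ≈S σ (σ (Π n))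
  σξ-*-σxiProd-suc n = SR.trans (SR.sym (substR-*S 1 ξ (Π (suc n)))) (substR-cong 1 (ξ-*-xiProd-suc n))

  σ²ξ-*-σ²xiProd-suc : ∀ n → substR 2 ξ *S σ (σ (Π (suc n))) ≈S σ (σ (σ (Π n)))
  σ²ξ-*-σ²xiProd-suc n = begin
    substR 2 ξ *S σ (σ (Π (suc n)))  ≈⟨ *S-congʳ (σ (σ (Π (suc n)))) _ _ (SR.sym (substR-substR 1 1 ξ)) ⟩
    σ (σ ξ) *S σ (σ (Π (suc n)))     ≈⟨ SR.sym (substR-*S 1 (σ ξ) (σ (Π (suc n)))) ⟩
    σ (σ ξ *S σ (Π (suc n)))         ≈⟨ substR-cong 1 (σξ-*-σxiProd-suc n) ⟩
    σ (σ (σ (Π n)))                  ∎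

  -- multiply the defining equation of ξ by Π (n + 3)
  xiProd-recurrence : ∀ n → Π (3 ℕ.+ n) ≈S recurrence (Π (2 ℕ.+ n)) (Π (1 ℕ.+ n)) (Π n)
  xiProd-recurrence n = begin
    Π₃                  ≈⟨ SR.sym (SR.*-identityˡ Π₃) ⟩
    1S *S Π₃            ≈⟨ *S-congʳ Π₃ _ _ (IsXi.equation isXi) ⟩
    xiEqRHS ξ *S Π₃     ≈⟨ solve 7 (λ A B C x x₁ x₂ p → (A :* x :+ B :* x :* x₁ :+ C :* x :* x₁ :* x₂) :* p
                             := A :* (x :* p) :+ B :* (x₁ :* (x :* p)) :+ C :* (x₂ :* (x₁ :* (x :* p))))
                           SR.refl xiCoeff₁ xiCoeff₂ xiCoeff₃ ξ (σ ξ) (substR 2 ξ) Π₃ ⟩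
    xiCoeff₁ *S (ξ *S Π₃) +S xiCoeff₂ *S (σ ξ *S (ξ *S Π₃)) +S xiCoeff₃ *S (substR 2 ξ *S (σ ξ *S (ξ *S Π₃)))
                        ≈⟨ +S-cong (+S-cong (*S-congˡ xiCoeff₁ _ _ ξΠ₃) (*S-congˡ xiCoeff₂ _ _ σξξΠ₃)) (*S-congˡ xiCoeff₃ _ _ σ²ξσξξΠ₃) ⟩
    recurrence (Π (2 ℕ.+ n)) (Π (1 ℕ.+ n)) (Π n) ∎
    where
    Π₃ = Π (3 ℕ.+ n)
    ξΠ₃ : ξ *S Π₃ ≈S σ (Π (2 ℕ.+ n))
    ξΠ₃ = ξ-*-xiProd-suc (2 ℕ.+ n)
    σξξΠ₃ : σ ξ *S (ξ *S Π₃) ≈S σ (σ (Π (1 ℕ.+ n)))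
    σξξΠ₃ = SR.trans (*S-congˡ (σ ξ) _ _ ξΠ₃) (σξ-*-σxiProd-suc (1 ℕ.+ n))
    σ²ξσξξΠ₃ : substR 2 ξ *S (σ ξ *S (ξ *S Π₃)) ≈S σ (σ (σ (Π n)))
    σ²ξσξξΠ₃ = SR.trans (*S-congˡ (substR 2 ξ) _ _ σξξΠ₃) (σ²ξ-*-σ²xiProd-suc n)

  xiProd-constTerm : ∀ n → ConstTermOne (Π n)
  xiProd-constTerm n = prodBelow-constTerm n _ λ j →
    Inverse.invS-constTerm (substR j ξ) (substR-constTerm j ξ ξ₀)

  xiProd-stabilises : Stabilises Π
  xiProd-stabilises n =
    on-trans (*S-congˡ-on (S<-downClosed n) (Π n) factor≈1) (≈S⇒on (SR.*-identityʳ (Π n)))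
    where
    factor≈1 : invS (substR n ξ) ≈S 1S on S< n
    factor≈1 = on-trans (≈S⇒on (SR.sym (substR-invS n ξ ξ₀)))
                        (substR-S< n (invS ξ) (Inverse.invS-constTerm ξ ξ₀))

-- Segment sums

sumList-++ : ∀ xs ys → sumList (xs ++ ys) ≈S sumList xs +S sumList ys
sumList-++ []       ys = SR.sym (SR.+-identityˡ (sumList ys))
sumList-++ (x ∷ xs) ys = SR.trans (+S-congˡ x (sumList-++ xs ys)) (SR.sym (SR.+-assoc x (sumList xs) (sumList ys)))

sumList-map-cong : ∀ {A : Set} {f g : A → Series} xs → (∀ x → f x ≈S g x) → sumList (map f xs) ≈S sumList (map g xs)
sumList-map-cong []       f≈g = SR.refl {0S}
sumList-map-cong (x ∷ xs) f≈g = +S-cong (f≈g x) (sumList-map-cong xs f≈g)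

*S-sumList : ∀ {A : Set} u (f : A → Series) xs → u *S sumList (map f xs) ≈S sumList (map (λ x → u *S f x) xs)
*S-sumList u f []       = SR.zeroʳ u
*S-sumList u f (x ∷ xs) = SR.trans (SR.distribˡ u (f x) (sumList (map f xs))) (+S-congˡ (u *S f x) (*S-sumList u f xs))

σ-sumList : ∀ {A : Set} (f : A → Series) xs → σ (sumList (map f xs)) ≈S sumList (map (σ ∘ f) xs)
σ-sumList f []       a b c = shift-zero (1 ℕ.* b) (λ _ → 0ℤ) c λ _ → refl
σ-sumList f (x ∷ xs) = SR.trans (substR-+S 1 (f x) (sumList (map f xs))) (+S-congˡ (σ (f x)) (σ-sumList f xs))

sum-allSubsets-suc : ∀ l (f : List Bool → Series) →
  sumList (map f (allSubsets (suc l))) ≈S sumList (map (f ∘ (false ∷_)) (allSubsets l)) +S sumList (map (f ∘ (true ∷_)) (allSubsets l))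
sum-allSubsets-suc l f = begin
  sumList (map f (map (false ∷_) A ++ map (true ∷_) A))               ≡⟨ cong sumList (ListP.map-++ f (map (false ∷_) A) _) ⟩
  sumList (map f (map (false ∷_) A) ++ map f (map (true ∷_) A))       ≈⟨ sumList-++ (map f (map (false ∷_) A)) _ ⟩
  sumList (map f (map (false ∷_) A)) +S sumList (map f (map (true ∷_) A))
    ≡⟨ cong₂ (λ u v → sumList u +S sumList v) (ListP.map-∘ A) (ListP.map-∘ A) ⟨
  sumList (map (f ∘ (false ∷_)) A) +S sumList (map (f ∘ (true ∷_)) A) ∎
  where A = allSubsets l

runsFrom≤size : ∀ p S → runsFrom p S ≤ size S
runsFrom≤size p     []          = z≤n
runsFrom≤size p     (false ∷ S) = runsFrom≤size false S
runsFrom≤size true  (true ∷ S)  = ℕP.m≤n⇒m≤1+n (runsFrom≤size true S)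
runsFrom≤size false (true ∷ S)  = s≤s (runsFrom≤size true S)

sigmaFrom-suc : ∀ k S → sigmaFrom (suc k) S ≡ sigmaFrom k S ℕ.+ size S
sigmaFrom-suc k []          = refl
sigmaFrom-suc k (false ∷ S) = sigmaFrom-suc (suc k) S
sigmaFrom-suc k (true ∷ S)  = trans (cong (suc k ℕ.+_) (sigmaFrom-suc (suc k) S))
  (trans (cong suc (sym (ℕP.+-assoc k _ _))) (sym (ℕP.+-suc (k ℕ.+ sigmaFrom (suc k) S) (size S))))

-- the weight of S ⊆ {k,…,k+l-1}; the flag p records whether k - 1 is taken to lie in S
weight : ℕ → Bool → List Bool → Series
weight k p S = sS ^S sigmaFrom k S *S rS ^S size S *S mS ^S runsFrom p S *S wS ^S (size S ∸ runsFrom p S)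

weightSum : ℕ → Bool → ℕ → Series
weightSum k p l = sumList (map (weight k p) (allSubsets l))

-- Gs l = weightSum 1 false l; Gs⁺ is the variant where a run is already open before 1
Gs⁺ : ℕ → Series
Gs⁺ = weightSum 1 true

-- an element of S contributes m if it starts a run and m - 1 if it continues one
runFactor : Bool → Series
runFactor true  = wS
runFactor false = mS

σ-wS : σ wS ≈S wS
σ-wS = SR.trans (substR-+S 1 mS (-S 1S)) (+S-cong (substR-mS 1) (SR.trans (substR--S 1 1S) (-S-cong (substR-1S 1))))

σ-rS : σ rS ≈S sS *S rS
σ-rS = SR.trans (substR-rS 1) (*S-congʳ rS _ _ (SR.*-identityʳ sS))

σ-sS*rS : σ (sS *S rS) ≈S sS *S (sS *S rS)
σ-sS*rS = SR.trans (substR-*S 1 sS rS) (*S-cong _ _ _ _ (substR-sS 1) σ-rS)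

σ-weight : ∀ k p S → σ (weight k p S) ≈S weight (suc k) p S
σ-weight k p S = begin
  σ (s^ *S r^ *S m^ *S w^)
    ≈⟨ SR.trans (substR-*S 1 (s^ *S r^ *S m^) w^) (*S-congʳ (σ w^) _ _ (SR.trans (substR-*S 1 (s^ *S r^) m^) (*S-congʳ (σ m^) _ _ (substR-*S 1 s^ r^)))) ⟩
  σ s^ *S σ r^ *S σ m^ *S σ w^
    ≈⟨ *S-cong _ _ _ _ (*S-cong _ _ _ _ (*S-cong _ _ _ _ σs^ σr^) σm^) σw^ ⟩
  s^ *S (sS ^S n *S r^) *S m^ *S w^
    ≈⟨ solve 5 (λ a b r m w → a :* (b :* r) :* m :* w := a :* b :* r :* m :* w) SR.refl s^ (sS ^S n) r^ m^ w^ ⟩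
  s^ *S sS ^S n *S r^ *S m^ *S w^
    ≈⟨ *S-congʳ w^ _ _ (*S-congʳ m^ _ _ (*S-congʳ r^ _ _ (SR.trans (SR.sym (^S-+ sS x n))
         λ a b c → cong (λ z → (sS ^S z) a b c) (sym (sigmaFrom-suc k S))))) ⟩
  weight (suc k) p S ∎
  where
  x = sigmaFrom k S
  n = size S
  R = runsFrom p S
  s^ = sS ^S x
  r^ = rS ^S n
  m^ = mS ^S R
  w^ = wS ^S (n ∸ R)
  σs^ : σ s^ ≈S s^
  σs^ = SR.trans (substR-^S 1 sS x) (^S-cong x (substR-sS 1))
  σr^ : σ r^ ≈S sS ^S n *S r^
  σr^ = SR.trans (substR-^S 1 rS n) (SR.trans (^S-cong n σ-rS) (^S-*S sS rS n))
  σm^ : σ m^ ≈S m^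
  σm^ = SR.trans (substR-^S 1 mS R) (^S-cong R (substR-mS 1))
  σw^ : σ w^ ≈S w^
  σw^ = SR.trans (substR-^S 1 wS (n ∸ R)) (^S-cong (n ∸ R) σ-wS)

weight-true∷ : ∀ k p S → weight k p (true ∷ S) ≈S sS ^S k *S rS *S runFactor p *S weight (suc k) true S
weight-true∷ k true S = begin
  sS ^S (k ℕ.+ x) *S (rS *S rS ^S n) *S mS ^S R *S wS ^S (suc n ∸ R)
    ≈⟨ *S-cong _ _ _ _ (*S-congʳ (mS ^S R) _ _ (*S-congʳ (rS *S rS ^S n) _ _ (^S-+ sS k x)))
         (λ a b c → cong (λ z → (wS ^S z) a b c) (ℕP.+-∸-assoc 1 (runsFrom≤size true S))) ⟩
  sS ^S k *S sS ^S x *S (rS *S rS ^S n) *S mS ^S R *S (wS *S wS ^S (n ∸ R))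
    ≈⟨ solve 7 (λ a b r c m w d → a :* b :* (r :* c) :* m :* (w :* d) := a :* r :* w :* (b :* c :* m :* d)) SR.refl
         (sS ^S k) (sS ^S x) rS (rS ^S n) (mS ^S R) wS (wS ^S (n ∸ R)) ⟩
  sS ^S k *S rS *S wS *S weight (suc k) true S ∎
  where
  x = sigmaFrom (suc k) S
  n = size S
  R = runsFrom true S
weight-true∷ k false S = begin
  sS ^S (k ℕ.+ x) *S (rS *S rS ^S n) *S (mS *S mS ^S R) *S wS ^S (n ∸ R)
    ≈⟨ *S-congʳ (wS ^S (n ∸ R)) _ _ (*S-congʳ (mS *S mS ^S R) _ _ (*S-congʳ (rS *S rS ^S n) _ _ (^S-+ sS k x))) ⟩
  sS ^S k *S sS ^S x *S (rS *S rS ^S n) *S (mS *S mS ^S R) *S wS ^S (n ∸ R)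
    ≈⟨ solve 7 (λ a b r c m e d → a :* b :* (r :* c) :* (m :* e) :* d := a :* r :* m :* (b :* c :* e :* d)) SR.refl
         (sS ^S k) (sS ^S x) rS (rS ^S n) mS (mS ^S R) (wS ^S (n ∸ R)) ⟩
  sS ^S k *S rS *S mS *S weight (suc k) true S ∎
  where
  x = sigmaFrom (suc k) S
  n = size S
  R = runsFrom true S

weightSum-suc : ∀ k p l →
  weightSum k p (suc l) ≈S σ (weightSum k false l) +S sS ^S k *S rS *S runFactor p *S σ (weightSum k true l)
weightSum-suc k p l = begin
  weightSum k p (suc l)
    ≈⟨ sum-allSubsets-suc l (weight k p) ⟩
  weightSum (suc k) false l +S sumList (map (λ S → weight k p (true ∷ S)) A)
    ≈⟨ +S-cong (SR.sym (σ-weightSum false)) (SR.trans (sumList-map-cong A (weight-true∷ k p))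
         (SR.trans (SR.sym (*S-sumList (sS ^S k *S rS *S runFactor p) (weight (suc k) true) A))
                   (*S-congˡ (sS ^S k *S rS *S runFactor p) _ _ (SR.sym (σ-weightSum true))))) ⟩
  σ (weightSum k false l) +S sS ^S k *S rS *S runFactor p *S σ (weightSum k true l) ∎
  where
  A = allSubsets l
  σ-weightSum : ∀ q → σ (weightSum k q l) ≈S weightSum (suc k) q l
  σ-weightSum q = SR.trans (σ-sumList (weight k q) A) (sumList-map-cong A (σ-weight k q))

Gs-suc : ∀ l → Gs (suc l) ≈S σ (Gs l) +S sS *S rS *S mS *S σ (Gs⁺ l)
Gs-suc l = SR.trans (weightSum-suc 1 false l)
  (+S-congˡ (σ (Gs l)) (*S-congʳ (σ (Gs⁺ l)) _ _ (*S-congʳ mS _ _ (*S-congʳ rS _ _ (SR.*-identityʳ sS)))))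

Gs⁺-suc : ∀ l → Gs⁺ (suc l) ≈S σ (Gs l) +S sS *S rS *S wS *S σ (Gs⁺ l)
Gs⁺-suc l = SR.trans (weightSum-suc 1 true l)
  (+S-congˡ (σ (Gs l)) (*S-congʳ (σ (Gs⁺ l)) _ _ (*S-congʳ wS _ _ (*S-congʳ rS _ _ (SR.*-identityʳ sS)))))

Gs-suc≈Gs⁺-suc : ∀ l → Gs (suc l) ≈S Gs⁺ (suc l) +S sS *S rS *S σ (Gs⁺ l)
Gs-suc≈Gs⁺-suc l = begin
  Gs (suc l)                                          ≈⟨ Gs-suc l ⟩
  σ (Gs l) +S sS *S rS *S mS *S σ (Gs⁺ l)             ≈⟨ +S-congˡ (σ (Gs l)) (*S-congʳ (σ (Gs⁺ l)) _ _ (*S-congˡ (sS *S rS) _ _ mS≈wS+1S)) ⟩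
  σ (Gs l) +S sS *S rS *S (wS +S 1S) *S σ (Gs⁺ l)
    ≈⟨ solve 5 (λ G s r w G⁺ → G :+ s :* r :* (w :+ con 1) :* G⁺ := (G :+ s :* r :* w :* G⁺) :+ s :* r :* G⁺) SR.refl
         (σ (Gs l)) sS rS wS (σ (Gs⁺ l)) ⟩
  (σ (Gs l) +S sS *S rS *S wS *S σ (Gs⁺ l)) +S sS *S rS *S σ (Gs⁺ l) ≈⟨ +S-congʳ (sS *S rS *S σ (Gs⁺ l)) (SR.sym (Gs⁺-suc l)) ⟩
  Gs⁺ (suc l) +S sS *S rS *S σ (Gs⁺ l)                ∎

Gs⁺-two-term : ∀ l → Gs⁺ (2 ℕ.+ l) ≈S (1S +S sS *S rS *S wS) *S σ (Gs⁺ (1 ℕ.+ l)) +S sS *S (sS *S rS) *S σ (σ (Gs⁺ l))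
Gs⁺-two-term l = begin
  Gs⁺ (2 ℕ.+ l)
    ≈⟨ Gs⁺-suc (suc l) ⟩
  σ (Gs (suc l)) +S sS *S rS *S wS *S σ (Gs⁺ (suc l))
    ≈⟨ +S-congʳ (sS *S rS *S wS *S σ (Gs⁺ (suc l))) (SR.trans (substR-cong 1 (Gs-suc≈Gs⁺-suc l))
         (SR.trans (substR-+S 1 (Gs⁺ (suc l)) (sS *S rS *S σ (Gs⁺ l))) (+S-congˡ (σ (Gs⁺ (suc l)))
           (SR.trans (substR-*S 1 (sS *S rS) (σ (Gs⁺ l))) (*S-congʳ (σ (σ (Gs⁺ l))) _ _ σ-sS*rS))))) ⟩
  σ (Gs⁺ (suc l)) +S sS *S (sS *S rS) *S σ (σ (Gs⁺ l)) +S sS *S rS *S wS *S σ (Gs⁺ (suc l))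
    ≈⟨ solve 5 (λ P s r w Q → P :+ s :* (s :* r) :* Q :+ s :* r :* w :* P := (con 1 :+ s :* r :* w) :* P :+ s :* (s :* r) :* Q)
         SR.refl (σ (Gs⁺ (suc l))) sS rS wS (σ (σ (Gs⁺ l))) ⟩
  (1S +S sS *S rS *S wS) *S σ (Gs⁺ (1 ℕ.+ l)) +S sS *S (sS *S rS) *S σ (σ (Gs⁺ l)) ∎

xiCoeff₁+rs : xiCoeff₁ +S rS *S sS ≈S 1S +S sS *S rS *S wS
xiCoeff₁+rs = begin
  1S +S rS *S sS *S tS +S rS *S sS
    ≈⟨ solve 3 (λ r s t → con 1 :+ r :* s :* t :+ r :* s := con 1 :+ s :* r :* (t :+ con 1)) SR.refl rS sS tS ⟩
  1S +S sS *S rS *S (tS +S 1S)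
    ≈⟨ +S-congˡ 1S (*S-congˡ (sS *S rS) _ _ (SR.sym wS≈tS+1S)) ⟩
  1S +S sS *S rS *S wS ∎

Gs⁺-recurrence : SatisfiesRecurrence Gs⁺
Gs⁺-recurrence l = begin
  Gs⁺ (3 ℕ.+ l)
    ≈⟨ Gs⁺-two-term (suc l) ⟩
  (1S +S sS *S rS *S wS) *S P +S sS *S (sS *S rS) *S Y₂
    ≈⟨ +S-congʳ (sS *S (sS *S rS) *S Y₂) (*S-congʳ P _ _ (SR.sym xiCoeff₁+rs)) ⟩
  (xiCoeff₁ +S rS *S sS) *S P +S sS *S (sS *S rS) *S Y₂
    ≈⟨ solve 5 (λ A r s P Y → (A :+ r :* s) :* P :+ s :* (s :* r) :* Y := A :* P :+ (r :* s :* P :+ s :* (s :* r) :* Y))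
         SR.refl xiCoeff₁ rS sS P Y₂ ⟩
  xiCoeff₁ *S P +S (rS *S sS *S P +S sS *S (sS *S rS) *S Y₂)
    ≈⟨ +S-congˡ (xiCoeff₁ *S P) (+S-congʳ (sS *S (sS *S rS) *S Y₂) (*S-congˡ (rS *S sS) _ _ σ-two-term)) ⟩
  xiCoeff₁ *S P +S (rS *S sS *S ((1S +S sS *S (sS *S rS) *S wS) *S Y₂ +S sS *S (sS *S (sS *S rS)) *S Y₃) +S sS *S (sS *S rS) *S Y₂)
    ≈⟨ solve 6 (λ A r s w Y Z →
         A :+ (r :* s :* ((con 1 :+ s :* (s :* r) :* w) :* Y :+ s :* (s :* (s :* r)) :* Z) :+ s :* (s :* r) :* Y)
         := A :+ r :* s :* (con 1 :+ s :+ r :* s :^ 2 :* w) :* Y :+ r :^ 2 :* s :^ 4 :* Z)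
         SR.refl (xiCoeff₁ *S P) rS sS wS Y₂ Y₃ ⟩
  recurrence (Gs⁺ (2 ℕ.+ l)) (Gs⁺ (1 ℕ.+ l)) (Gs⁺ l) ∎
  where
  P  = σ (Gs⁺ (2 ℕ.+ l))
  Y₂ = σ (σ (Gs⁺ (1 ℕ.+ l)))
  Y₃ = σ (σ (σ (Gs⁺ l)))
  σ-two-term : P ≈S (1S +S sS *S (sS *S rS) *S wS) *S Y₂ +S sS *S (sS *S (sS *S rS)) *S Y₃
  σ-two-term =
    SR.trans (substR-cong 1 (Gs⁺-two-term l))
    (SR.trans (substR-+S 1 ((1S +S sS *S rS *S wS) *S σ (Gs⁺ (1 ℕ.+ l))) (sS *S (sS *S rS) *S σ (σ (Gs⁺ l))))
    (+S-cong (SR.trans (substR-*S 1 (1S +S sS *S rS *S wS) (σ (Gs⁺ (1 ℕ.+ l)))) (*S-congʳ Y₂ _ _ σ-coeff₁))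
             (SR.trans (substR-*S 1 (sS *S (sS *S rS)) (σ (σ (Gs⁺ l)))) (*S-congʳ Y₃ _ _ σ-coeff₂))))
    where
    σ-coeff₁ : σ (1S +S sS *S rS *S wS) ≈S 1S +S sS *S (sS *S rS) *S wS
    σ-coeff₁ = SR.trans (substR-+S 1 1S (sS *S rS *S wS))
      (+S-cong (substR-1S 1) (SR.trans (substR-*S 1 (sS *S rS) wS) (*S-cong _ _ _ _ σ-sS*rS σ-wS)))
    σ-coeff₂ : σ (sS *S (sS *S rS)) ≈S sS *S (sS *S (sS *S rS))
    σ-coeff₂ = SR.trans (substR-*S 1 sS (sS *S rS)) (*S-cong _ _ _ _ (substR-sS 1) σ-sS*rS)

NotDivBy-rs^ : ℕ → Degrees
NotDivBy-rs^ n b c = b ≡ 0 ⊎ c < n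

NotDivBy-rs^-downClosed : ∀ n → DownClosed (NotDivBy-rs^ n)
NotDivBy-rs^-downClosed n b′≤b _     (inj₁ refl) = inj₁ (ℕP.n≤0⇒n≡0 b′≤b)
NotDivBy-rs^-downClosed n _    c′≤c (inj₂ c<n)  = inj₂ (ℕP.≤-<-trans c′≤c c<n)

-- the coefficient of r^b s^c with b ≥ 1 comes from s-degree c - b < c
σ-on-NotDivBy-rs^ : ∀ n {f g} → f ≈S g on NotDivBy-rs^ n → σ f ≈S σ g on NotDivBy-rs^ (suc n)
σ-on-NotDivBy-rs^ n = σ-on lower
  where
  lower : ∀ {b c} → b ≤ c → NotDivBy-rs^ (suc n) b c → NotDivBy-rs^ n b (c ∸ b)
  lower _   (inj₁ b≡0)  = inj₁ b≡0
  lower {zero}  _   (inj₂ _)    = inj₁ refl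
  lower {suc b} b≤c (inj₂ c<1+n) = inj₂ (ℕP.<-≤-trans (ℕP.∸-monoʳ-< {o = 0} (s≤s z≤n) b≤c) (ℕP.≤-pred c<1+n))

σ-on-r⁰ : ∀ f → σ f ≈S f on NotDivBy-rs^ 0
σ-on-r⁰ f a b c (inj₁ refl) = refl

rS-multiple-on-r⁰ : ∀ f g → f +S rS *S g ≈S f on NotDivBy-rs^ 0
rS-multiple-on-r⁰ f g a b c (inj₁ refl) =
  trans (cong (λ z → f a 0 c ℤ.+ z) (rS-*S g a 0 c)) (ℤP.+-identityʳ (f a 0 c))

rS-to-front : ∀ u g → sS *S rS *S u *S g ≈S rS *S (sS *S u *S g)
rS-to-front u g = solve 4 (λ s r u g → s :* r :* u :* g := r :* (s :* u :* g)) SR.refl sS rS u g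

Gs-Gs⁺-stabilise : ∀ l → Gs (suc l) ≈S Gs l on NotDivBy-rs^ l × Gs⁺ (suc l) ≈S Gs⁺ l on NotDivBy-rs^ l
Gs-Gs⁺-stabilise zero = from-r⁰ mS (Gs-suc 0) , from-r⁰ wS (Gs⁺-suc 0)
  where
  from-r⁰ : ∀ u {F} → F ≈S σ (Gs 0) +S sS *S rS *S u *S σ (Gs⁺ 0) → F ≈S Gs 0 on NotDivBy-rs^ 0
  from-r⁰ u F≈ = on-trans (≈S⇒on (SR.trans F≈ (+S-congˡ (σ (Gs 0)) (rS-to-front u (σ (Gs⁺ 0))))))
                          (on-trans (rS-multiple-on-r⁰ (σ (Gs 0)) (sS *S u *S σ (Gs⁺ 0))) (σ-on-r⁰ (Gs 0)))
Gs-Gs⁺-stabilise (suc l) with Gs-Gs⁺-stabilise l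
... | Gs-stab , Gs⁺-stab = step mS (Gs-suc (suc l)) (Gs-suc l) , step wS (Gs⁺-suc (suc l)) (Gs⁺-suc l)
  where
  step : ∀ u {F F′} →
    F ≈S σ (Gs (suc l)) +S sS *S rS *S u *S σ (Gs⁺ (suc l)) → F′ ≈S σ (Gs l) +S sS *S rS *S u *S σ (Gs⁺ l) →
    F ≈S F′ on NotDivBy-rs^ (suc l)
  step u F≈ F′≈ = on-trans (≈S⇒on F≈) (on-trans
    (+S-on (σ-on-NotDivBy-rs^ l Gs-stab)
           (*S-congˡ-on (NotDivBy-rs^-downClosed (suc l)) (sS *S rS *S u) (σ-on-NotDivBy-rs^ l Gs⁺-stab)))
    (on-sym (≈S⇒on F′≈)))

Gs⁺-stabilises : Stabilises Gs⁺
Gs⁺-stabilises l = on-weaken inj₂ (proj₂ (Gs-Gs⁺-stabilise l))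

Gs⁺-constTerm : ∀ l → ConstTermOne (Gs⁺ l)
Gs⁺-constTerm zero    a c = SR.trans (SR.+-identityʳ _) (SR.trans (SR.*-identityʳ _) (SR.trans (SR.*-identityʳ _) (SR.*-identityʳ 1S))) a 0 c
Gs⁺-constTerm (suc l) a c = trans (proj₂ (Gs-Gs⁺-stabilise l) a 0 c (inj₁ refl)) (Gs⁺-constTerm l a c)

-- Cyclic sums

sum-allSubsets-snoc : ∀ l (f : List Bool → Series) →
  sumList (map f (allSubsets (suc l))) ≈S
  sumList (map (λ xs → f (xs ++ [ false ])) (allSubsets l)) +S sumList (map (λ xs → f (xs ++ [ true ])) (allSubsets l))
sum-allSubsets-snoc zero    f = sum-allSubsets-suc 0 f
sum-allSubsets-snoc (suc l) f = begin
  sumList (map f (allSubsets (2 ℕ.+ l)))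
    ≈⟨ sum-allSubsets-suc (suc l) f ⟩
  sumList (map (f ∘ (false ∷_)) (allSubsets (suc l))) +S sumList (map (f ∘ (true ∷_)) (allSubsets (suc l)))
    ≈⟨ +S-cong (sum-allSubsets-snoc l (f ∘ (false ∷_))) (sum-allSubsets-snoc l (f ∘ (true ∷_))) ⟩
  (Σ false false +S Σ false true) +S (Σ true false +S Σ true true)
    ≈⟨ interchange (Σ false false) (Σ false true) (Σ true false) (Σ true true) ⟩
  (Σ false false +S Σ true false) +S (Σ false true +S Σ true true)
    ≈⟨ +S-cong (SR.sym (sum-allSubsets-suc l λ xs → f (xs ++ [ false ]))) (SR.sym (sum-allSubsets-suc l λ xs → f (xs ++ [ true ]))) ⟩
  sumList (map (λ xs → f (xs ++ [ false ])) (allSubsets (suc l))) +S sumList (map (λ xs → f (xs ++ [ true ])) (allSubsets (suc l))) ∎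
  where
  Σ : Bool → Bool → Series
  Σ x y = sumList (map (λ xs → f (x ∷ xs ++ [ y ])) (allSubsets l))
  open CommutativeSemigroupProperties SR.+-commutativeSemigroup using (interchange)

sum-allSubsets-coeff-cong : ∀ l {f g : List Bool → Series} a b c a′ b′ c′ →
  (∀ xs → length xs ≡ l → f xs a b c ≡ g xs a′ b′ c′) →
  sumList (map f (allSubsets l)) a b c ≡ sumList (map g (allSubsets l)) a′ b′ c′
sum-allSubsets-coeff-cong zero    a b c a′ b′ c′ f≡g = cong (ℤ._+ 0ℤ) (f≡g [] refl)
sum-allSubsets-coeff-cong (suc l) {f} {g} a b c a′ b′ c′ f≡g =
  trans (sum-allSubsets-suc l f a b c)
  (trans (cong₂ ℤ._+_ (sum-allSubsets-coeff-cong l a b c a′ b′ c′ λ xs e → f≡g (false ∷ xs) (cong suc e))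
                      (sum-allSubsets-coeff-cong l a b c a′ b′ c′ λ xs e → f≡g (true ∷ xs) (cong suc e)))
         (sym (sum-allSubsets-suc l g a′ b′ c′)))

sigmaFrom-++false : ∀ k xs → sigmaFrom k (xs ++ [ false ]) ≡ sigmaFrom k xs
sigmaFrom-++false k []       = refl
sigmaFrom-++false k (x ∷ xs) = cong ((if x then k else 0) ℕ.+_) (sigmaFrom-++false (suc k) xs)

size-++false : ∀ xs → size (xs ++ [ false ]) ≡ size xs
size-++false []          = refl
size-++false (false ∷ xs) = size-++false xs
size-++false (true ∷ xs)  = cong suc (size-++false xs)

runsFrom-++false : ∀ p xs → runsFrom p (xs ++ [ false ]) ≡ runsFrom p xs
runsFrom-++false p []          = refl
runsFrom-++false p (false ∷ xs) = runsFrom-++false false xs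
runsFrom-++false p (true ∷ xs)  = cong ((if p then 0 else 1) ℕ.+_) (runsFrom-++false true xs)

lastB-++ : ∀ xs y → lastB (xs ++ [ y ]) ≡ y
lastB-++ []           y = refl
lastB-++ (x ∷ [])     y = refl
lastB-++ (x ∷ z ∷ zs) y = lastB-++ (z ∷ zs) y

and-++false : ∀ xs → and (xs ++ [ false ]) ≡ false
and-++false []          = refl
and-++false (false ∷ xs) = refl
and-++false (true ∷ xs)  = and-++false xs

cycTerm-++false : ∀ n xs → cycTerm n (xs ++ [ false ]) ≈S segTerm xs
cycTerm-++false n xs rewrite and-++false xs | lastB-++ xs false | runsFrom-++false false xs
                           | size-++false xs | sigmaFrom-++false 1 xs =
  SR.sym (SR.*-assoc (sS ^S sigma xs *S rS ^S size xs) (mS ^S runsSeg xs) (wS ^S (size xs ∸ runsSeg xs)))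

sigmaFrom-++true : ∀ k xs → sigmaFrom k (xs ++ [ true ]) ≡ sigmaFrom k xs ℕ.+ (k ℕ.+ length xs)
sigmaFrom-++true k []       = refl
sigmaFrom-++true k (x ∷ xs) = trans (cong ((if x then k else 0) ℕ.+_) (sigmaFrom-++true (suc k) xs))
  (trans (sym (ℕP.+-assoc (if x then k else 0) (sigmaFrom (suc k) xs) _))
         (cong ((if x then k else 0) ℕ.+ sigmaFrom (suc k) xs ℕ.+_) (sym (ℕP.+-suc k (length xs)))))

size-++true : ∀ xs → size (xs ++ [ true ]) ≡ suc (size xs)
size-++true []          = refl
size-++true (false ∷ xs) = size-++true xs
size-++true (true ∷ xs)  = cong suc (size-++true xs)

runsFrom-++true : ∀ p xs → lastB xs ≡ false → 1 ≤ length xs → runsFrom p (xs ++ [ true ]) ≡ suc (runsFrom p xs)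
runsFrom-++true p (false ∷ [])     _  _ = refl
runsFrom-++true p (false ∷ z ∷ zs) eq _ = runsFrom-++true false (z ∷ zs) eq (s≤s z≤n)
runsFrom-++true p (true ∷ z ∷ zs)  eq _ =
  trans (cong ((if p then 0 else 1) ℕ.+_) (runsFrom-++true true (z ∷ zs) eq (s≤s z≤n))) (ℕP.+-suc _ _)

and-++true : ∀ xs → lastB xs ≡ false → 1 ≤ length xs → and (xs ++ [ true ]) ≡ false
and-++true (false ∷ zs)    _  _ = refl
and-++true (true ∷ z ∷ zs) eq _ = and-++true (z ∷ zs) eq (s≤s z≤n)

-- the last element of a list ending in true is k + length - 1
sigmaFrom-lastB-true : ∀ k xs → lastB xs ≡ true → k ℕ.+ length xs ≤ suc (sigmaFrom k xs)
sigmaFrom-lastB-true k (true ∷ [])   _  = ℕP.≤-reflexive (trans (ℕP.+-comm k 1) (cong suc (sym (ℕP.+-identityʳ k))))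
sigmaFrom-lastB-true k (y ∷ z ∷ zs) eq = ℕP.≤-trans (ℕP.≤-reflexive (ℕP.+-suc k _))
  (ℕP.≤-trans (sigmaFrom-lastB-true (suc k) (z ∷ zs) eq) (s≤s (ℕP.m≤n+m _ (if y then k else 0))))

-- as n - 1 ∉ S, the point n starts a new run (the factor m), and 1 continues it cyclically (hence Gs⁺)
cycTerm-++true : ∀ xs → lastB xs ≡ false → 1 ≤ length xs →
  cycTerm (suc (length xs)) (xs ++ [ true ]) ≈S sS ^S suc (length xs) *S (rS *S (mS *S weight 1 true xs))
cycTerm-++true xs eq 1≤len
  rewrite and-++true xs eq 1≤len | lastB-++ xs true | runsFrom-++true true xs eq 1≤len
        | size-++true xs | sigmaFrom-++true 1 xs = begin
  sS ^S (x ℕ.+ n) *S (rS *S rS ^S y) *S (mS *S mS ^S R *S wS ^S (y ∸ R))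
    ≈⟨ *S-congʳ (mS *S mS ^S R *S wS ^S (y ∸ R)) _ _ (*S-congʳ (rS *S rS ^S y) _ _ (^S-+ sS x n)) ⟩
  sS ^S x *S sS ^S n *S (rS *S rS ^S y) *S (mS *S mS ^S R *S wS ^S (y ∸ R))
    ≈⟨ solve 8 (λ a b r c m d w e → a :* b :* (r :* c) :* (m :* d :* e) := b :* (r :* (m :* (a :* c :* d :* e))))
         SR.refl (sS ^S x) (sS ^S n) rS (rS ^S y) mS (mS ^S R) wS (wS ^S (y ∸ R)) ⟩
  sS ^S n *S (rS *S (mS *S weight 1 true xs)) ∎
  where
  x = sigma xs
  n = suc (length xs)
  y = size xs
  R = runsFrom true xs

sS^-*S-below : ∀ k F a b c → c < k → (sS ^S k *S F) a b c ≡ 0ℤ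
sS^-*S-below k F a b c c<k = trans (sS^-*S k F a b c) (ℤ⟦s⟧.shift-< k (F a b) c<k)

sS^-rS-mS-*S-coeff : ∀ n W a b c → (sS ^S n *S (rS *S (mS *S W))) (suc a) (suc b) (c ℕ.+ n) ≡ W a b c
sS^-rS-mS-*S-coeff n W a b c =
  trans (sS^-*S n (rS *S (mS *S W)) (suc a) (suc b) (c ℕ.+ n))
  (trans (ℤ⟦s⟧.shift-≥ n ((rS *S (mS *S W)) (suc a) (suc b)) (ℕP.m≤n+m n c))
  (trans (cong ((rS *S (mS *S W)) (suc a) (suc b)) (ℕP.m+n∸n≡m c n))
  (trans (rS-*S (mS *S W) (suc a) (suc b) c) (mS-*S W (suc a) b c))))

-- if n - 1 ∈ S, both sides vanish since sigma S ≥ n - 1 > c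
cycTerm-++true-coeff : ∀ xs a b c → c < length xs →
  cycTerm (suc (length xs)) (xs ++ [ true ]) (suc a) (suc b) (c ℕ.+ suc (length xs)) ≡ weight 1 true xs a b c
cycTerm-++true-coeff xs a b c c<len with lastB xs in eq
... | false = trans (cycTerm-++true xs eq (ℕP.≤-trans (s≤s z≤n) c<len) (suc a) (suc b) (c ℕ.+ suc (length xs)))
                    (sS^-rS-mS-*S-coeff (suc (length xs)) (weight 1 true xs) a b c)
... | true  =
  trans (trans (SR.*-assoc (sS ^S sigma (xs ++ [ true ])) (rS ^S size (xs ++ [ true ])) (Pcyc n (xs ++ [ true ])) (suc a) (suc b) (c ℕ.+ n))
               (sS^-*S-below (sigma (xs ++ [ true ])) (rS ^S size (xs ++ [ true ]) *S Pcyc n (xs ++ [ true ])) (suc a) (suc b) (c ℕ.+ n) (P.subst (c ℕ.+ n <_) (sym (sigmaFrom-++true 1 xs)) (ℕP.+-monoˡ-< n c<σ))))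
  (sym (trans (trans (SR.*-assoc (sS ^S sigma xs *S rS ^S y) (mS ^S R) (wS ^S (y ∸ R)) a b c)
                     (SR.*-assoc (sS ^S sigma xs) (rS ^S y) (mS ^S R *S wS ^S (y ∸ R)) a b c))
              (sS^-*S-below (sigma xs) (rS ^S y *S (mS ^S R *S wS ^S (y ∸ R))) a b c c<σ)))
  where
  n = suc (length xs)
  y = size xs
  R = runsFrom true xs
  c<σ : c < sigma xs
  c<σ = ℕP.<-≤-trans c<len (ℕP.≤-pred (sigmaFrom-lastB-true 1 xs eq))

-- Gc n is special for n ≤ 2, hence n = 3 + k
normG2≈Gs⁺ : ∀ k → normG2 (3 ℕ.+ k) ≈S Gs⁺ (2 ℕ.+ k) on S< (2 ℕ.+ k)
normG2≈Gs⁺ k a b c c<l =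
  trans (cong (λ z → z ℤ.+ ℤ.- Gs l A B C) Gc≡Gs+Gs⁺) (xyx⁻¹≈y (Gs l A B C) (Gs⁺ l a b c))
  where
  open AbelianGroupProperties ℤP.+-0-abelianGroup using (xyx⁻¹≈y)
  l = 2 ℕ.+ k
  n = suc l
  A = suc a
  B = suc b
  C = c ℕ.+ n
  Gc≡Gs+Gs⁺ : Gc n A B C ≡ Gs l A B C ℤ.+ Gs⁺ l a b c
  Gc≡Gs+Gs⁺ = trans (sum-allSubsets-snoc l (cycTerm n) A B C)
    (cong₂ ℤ._+_ (sumList-map-cong (allSubsets l) (cycTerm-++false n) A B C)
                 (sum-allSubsets-coeff-cong l A B C a b c λ xs len≡l →
                    P.subst (λ m → cycTerm (suc m) (xs ++ [ true ]) A B (c ℕ.+ suc m) ≡ weight 1 true xs a b c) len≡l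
                            (cycTerm-++true-coeff xs a b c (P.subst (c <_) (sym len≡l) c<l))))

mainTheorem18 : (ξ : Series) → IsXi ξ →
    ∀ c → ∃[ N ] (∀ n → N ≤ n → ∀ a b → normG2 n a b c ≡ xiProd ξ n a b c)
mainTheorem18 ξ isXi c = 3 ℕ.+ c , agree
  where
  open XiProduct ξ isXi
  agree : ∀ n → 3 ℕ.+ c ≤ n → ∀ a b → normG2 n a b c ≡ Π n a b c
  agree (suc (suc (suc k))) (s≤s (s≤s (s≤s c≤k))) a b =
    trans (normG2≈Gs⁺ k a b c c<2+k)
    (trans (recurrence-solutions-agree Gs⁺-recurrence xiProd-recurrence Gs⁺-stabilises xiProd-stabilises
              (λ n a c → trans (Gs⁺-constTerm n a c) (sym (xiProd-constTerm n a c)))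
              (suc c) (2 ℕ.+ k) c<2+k a b c (ℕP.n<1+n c))
           (sym (xiProd-stabilises (2 ℕ.+ k) a b c c<2+k)))
    where
    c<2+k : c < 2 ℕ.+ k
    c<2+k = s≤s (ℕP.m≤n⇒m≤1+n c≤k)
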